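{- Let $T$ be an $s$-decreasing tree, and let $(a,b)$ and $(c,d)$ be tree ascents of $T$ with $1\le a<b\le n$, $1\le c<d\le n$ and $a<c$. Let $Z$ and $Q$ be the $s$-tree rotations of $T$ along $(a,b)$ and $(c,d)$, respectively. Then, in $s$-weak order, $$\mathrm{inv}(Z\vee Q)-\mathrm{inv}(T)=A_T(a,b)\cup A_T(c,d)\cup F_T(a,c).$$
   Context: $s=(s(1),\dots,s(n))$ is a sequence of nonnegative integers. An $s$-decreasing tree is a planar rooted tree $T$ whose internal vertices are labeled bijectively by $1,\dots,n$ (leaves unlabeled), such that internal vertex $i$ has exactly $s(i)+1$ children indexed $0,\dots,s(i)$ from left to right, and every labeled descendant of $i$ has smaller label. $T^i$ is the full subtree rooted at $i$, $T^i_j$ that rooted at the $j$-th child of $i$, $T^i\setminus 0$ is $T^i$ with $T^i_0$ replaced by a leaf. For $x<y$, $\#_T(y,x)$ is: $0$ if $x$ is left of $y$ or $x\in T^y_0$; $i$ if $x\in T^y_i$ with $0<i<s(y)$; $s(y)$ if $x\in T^y_{s(y)}$ or $x$ is right of $y$. $\mathrm{inv}(T)$ is the multiset of pairs $(y,x)$ with multiplicity $\#_T(y,x)$. For multisets $I,J$ of such pairs: $J-I$ has multiplicities $\max(\#_J-\#_I,0)$; $I\cup J$ has multiplicities $\max(\#_I,\#_J)$ (ordinary sets have multiplicities $1$); $I+(b,a)$ increases the multiplicity of $(b,a)$ by one, capped at $s(b)$; $I$ is transitive if for all $a<b<c$ with $\#_I(c,b)=i$, either $\#_I(b,a)=0$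 or $\#_I(c,a)\ge i$; $I^{tc}$ is the smallest transitive multiset containing $I$. $s$-weak order: $T\preceq Z$ iff $\#_T(y,x)\le\#_Z(y,x)$ for all pairs; it is a lattice with $\mathrm{inv}(T\vee Z)=(\mathrm{inv}(T)\cup\mathrm{inv}(Z))^{tc}$. For $a<b$, $(a,b)$ is a tree ascent of $T$ if (i) $a\in T^b_i$ for some $0\le i<s(b)$; (ii) whenever $a<e<b$ and $a\in T^e_j$, then $j=s(e)$; (iii) if $s(a)>0$ then $T^a_{s(a)}$ is a leaf. The $s$-tree rotation of $T$ along $(a,b)$ is the unique $s$-decreasing tree $Z'$ with $\mathrm{inv}(Z')=(\mathrm{inv}(T)+(b,a))^{tc}$, and $A_T(a,b)=\{(f,e):\#_{Z'}(f,e)>\#_T(f,e)\}$. For tree ascents $(a,b),(c,d)$ with $a<c$, $F_T(a,c)=\{(d,e):e\in T^a\setminus 0\}$ if $b=c$ and $a\in T^c_0$, and $F_T(a,c)=\emptyset$ otherwise. -}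

module Defs where

open import Data.Nat using (ℕ; zero; suc; _<_; _≤_; _∸_; _⊔_; _≟_; _<?_)
open import Data.Bool using (Bool; true; false; if_then_else_; _∧_; _∨_)
open import Data.Maybe using (Maybe; just; nothing)
open import Data.List using (List; []; _∷_; _++_; length; map; upTo)
open import Data.List.Relation.Unary.All using (All)
open import Data.List.Relation.Binary.Permutation.Propositional using (_↭_)
open import Data.Product using (_×_; ∃)
open import Data.Sum using (_⊎_)
open import Data.Unit using (⊤)
open import Relation.Nullary using (does)
open import Relation.Binary.PropositionalEquality using (_≡_)

-- A sequence s = (s(1),…,s(n)) is represented by a function ℕ → ℕ together
-- with n; only the values s 1, …, s n are ever used.

data Tree : Set where
  leaf : Tree
  node : ℕ → List Tree → Tree

mutual
  labels : Tree → List ℕ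
  labels leaf = []
  labels (node i cs) = i ∷ labelsL cs

  labelsL : List Tree → List ℕ
  labelsL [] = []
  labelsL (c ∷ cs) = labels c ++ labelsL cs

mutual
  Decreasing : (ℕ → ℕ) → Tree → Set
  Decreasing s leaf = ⊤
  Decreasing s (node i cs) =
    (length cs ≡ suc (s i)) × All (λ l → l < i) (labelsL cs) × DecreasingL s cs

  DecreasingL : (ℕ → ℕ) → List Tree → Set
  DecreasingL s [] = ⊤
  DecreasingL s (c ∷ cs) = Decreasing s c × DecreasingL s cs

IsSDecTree : (s : ℕ → ℕ) (n : ℕ) → Tree → Set
IsSDecTree s n T = (labels T ↭ map suc (upTo n)) × Decreasing s T

mutual
  pathTo : Tree → ℕ → Maybe (List ℕ)
  pathTo leaf x = nothing
  pathTo (node i cs) x = if does (i ≟ x) then just [] else pathToL 0 cs x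

  pathToL : ℕ → List Tree → ℕ → Maybe (List ℕ)
  pathToL k [] x = nothing
  pathToL k (c ∷ cs) x with pathTo c x
  ... | just p = just (k ∷ p)
  ... | nothing = pathToL (suc k) cs x

mutual
  subtree : Tree → ℕ → Maybe Tree
  subtree leaf x = nothing
  subtree (node i cs) x = if does (i ≟ x) then just (node i cs) else subtreeL cs x

  subtreeL : List Tree → ℕ → Maybe Tree
  subtreeL [] x = nothing
  subtreeL (c ∷ cs) x with subtree c x
  ... | just t = just t
  ... | nothing = subtreeL cs x

nth : {A : Set} → ℕ → List A → Maybe A
nth k [] = nothing
nth zero (x ∷ xs) = just x
nth (suc k) (x ∷ xs) = nth k xs

under : List ℕ → List ℕ → Maybe ℕ
under [] (j ∷ q) = just j
under [] [] = nothing
under (a ∷ p) [] = nothing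
under (a ∷ p) (b ∷ q) = if does (a ≟ b) then under p q else nothing

-- childIdx T e x ≡ just j  iff  x ∈ T^e_j
childIdx : Tree → ℕ → ℕ → Maybe ℕ
childIdx T e x with pathTo T e | pathTo T x
... | just pe | just px = under pe px
... | _ | _ = nothing

InChild : Tree → ℕ → ℕ → ℕ → Set
InChild T e j x = childIdx T e x ≡ just j

-- #_T(y,x) computed from paths py (of y) and px (of x), with sy = s(y):
-- x ∈ T^y_j gives j; x left of y gives 0; x right of y gives s(y).
cmpPath : ℕ → List ℕ → List ℕ → ℕ
cmpPath sy [] (j ∷ px) = j
cmpPath sy [] [] = 0
cmpPath sy (a ∷ py) [] = 0
cmpPath sy (a ∷ py) (b ∷ px) =
  if does (a ≟ b) then cmpPath sy py px
  else (if does (b <? a) then 0 else sy)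

-- Multisets of pairs (y,x), 1 ≤ x < y ≤ n : multiplicity functions
Multiset : Set
Multiset = ℕ → ℕ → ℕ

inv : (ℕ → ℕ) → Tree → Multiset
inv s T y x with pathTo T y | pathTo T x
... | just py | just px = cmpPath (s y) py px
... | _ | _ = 0

Pair : ℕ → ℕ → ℕ → Set
Pair n y x = (1 ≤ x) × (x < y) × (y ≤ n)

_⊑[_]_ : Multiset → ℕ → Multiset → Set
I ⊑[ n ] J = ∀ y x → Pair n y x → I y x ≤ J y x

plusPair : (ℕ → ℕ) → Multiset → ℕ → ℕ → Multiset
plusPair s I b a y x =
  if does (y ≟ b) then (if does (x ≟ a) then Data.Nat._⊓_ (suc (I b a)) (s b) else I y x)
  else I y x

Transitive : ℕ → Multiset → Set
Transitive n I = ∀ a b c → 1 ≤ a → a < b → b < c → c ≤ n →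
  (I b a ≡ 0) ⊎ (I c b ≤ I c a)

IsTC : ℕ → Multiset → Multiset → Set
IsTC n I J = Transitive n J × I ⊑[ n ] J ×
  (∀ K → Transitive n K → I ⊑[ n ] K → J ⊑[ n ] K)

_⪯[_,_]_ : Tree → (ℕ → ℕ) → ℕ → Tree → Set
T ⪯[ s , n ] Z = inv s T ⊑[ n ] inv s Z

IsJoin : (ℕ → ℕ) → ℕ → Tree → Tree → Tree → Set
IsJoin s n T Z W = IsSDecTree s n W × T ⪯[ s , n ] W × Z ⪯[ s , n ] W ×
  (∀ U → IsSDecTree s n U → T ⪯[ s , n ] U → Z ⪯[ s , n ] U → W ⪯[ s , n ] U)

IsTreeAscent : (ℕ → ℕ) → Tree → ℕ → ℕ → Set
IsTreeAscent s T a b =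
  (a < b)
  × (∃ λ i → (i < s b) × InChild T b i a)
  × (∀ e j → a < e → e < b → InChild T e j a → j ≡ s e)
  × (0 < s a → ∀ cs → subtree T a ≡ just (node a cs) → nth (s a) cs ≡ just leaf)

IsRotation : (ℕ → ℕ) → ℕ → Tree → ℕ → ℕ → Tree → Set
IsRotation s n T a b Z =
  IsSDecTree s n Z × IsTC n (plusPair s (inv s T) b a) (inv s Z)

-- A_T(a,b) as a set (multiplicities 0/1), given the rotation Z of T along (a,b)
Aset : (ℕ → ℕ) → Tree → Tree → Multiset
Aset s T Z f e = if does (inv s T f e <? inv s Z f e) then 1 else 0

-- F_T(a,c) as a set (multiplicities 0/1), for tree ascents (a,b),(c,d):
-- if b = c and a ∈ T^c_0 then {(d,e) : e ∈ T^a ∖ 0}, else ∅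
isChild0 : Maybe ℕ → Bool
isChild0 (just zero) = true
isChild0 _ = false

isChildPos : Maybe ℕ → Bool
isChildPos (just (suc j)) = true
isChildPos _ = false

inSubNot0 : Tree → ℕ → ℕ → Bool
inSubNot0 T a x = does (x ≟ a) ∨ isChildPos (childIdx T a x)

Fset : Tree → ℕ → ℕ → ℕ → ℕ → Multiset
Fset T a b c d y x =
  if does (b ≟ c) ∧ isChild0 (childIdx T c a) ∧ does (y ≟ d) ∧ inSubNot0 T a x
  then 1 else 0

module Submission where

-- The multisets inv(T) of s-decreasing trees are transitive, planar and bounded by s, and every such
-- multiset is inv of a tree (build it from the largest label down). Since inv(Z) and inv(Q) are the
-- smallest transitive multisets containing inv(T) + (b,a) and inv(T) + (c,d), inv(Z ∨ Q) lies below
-- any such multiset K containing both. We take for K the multiset inv(T) raised by one on the pairs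
-- (b,x) with x ∈ T^a ∖ 0, on the pairs (d,x) with x ∈ T^c ∖ 0, and, when b = c and a ∈ T^c_0, on the
-- pairs (d,x) with x ∈ T^a ∖ 0, and check the three axioms for it. So inv(Z ∨ Q) exceeds inv(T) by at
-- most one, and only on these pairs; conversely the first two kinds are already raised in Z or in Q,
-- and the third is forced by transitivity of Z ∨ Q through (c,a) and (d,c).

open import Defs
open import Data.Nat
open import Data.Nat.Properties
open import Data.Bool using (Bool; true; false; _∧_; _∨_; if_then_else_; T)
open import Data.Bool.Properties using (T-≡; T-∧; T-∨)
open import Function.Bundles using (_⇔_; mk⇔; Equivalence)
open import Function.Construct.Symmetry using (⇔-sym)
open import Function.Related.Propositional using (module EquationalReasoning; equivalence)
open import Data.Sum.Function.Propositional using (_⊎-⇔_)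
open import Data.List using (List; []; _∷_; _++_; length; map; upTo; filter; applyDownFrom)
open import Data.List.Properties
  using (++-identityʳ; ++-assoc; filter-all; filter-none; length-filter; map-downFrom; reverse-upTo; length-applyDownFrom)
open import Data.Maybe using (Maybe; just; nothing)
open import Data.Product using (∃; _×_; _,_; proj₁; proj₂)
open import Data.Sum using (_⊎_; inj₁; inj₂; [_,_]; map₁; map₂)
open import Data.Empty using (⊥-elim)
open import Data.Unit using (tt)
open import Relation.Nullary using (¬_; Dec; yes; no; does)
open import Relation.Nullary.Decidable using (dec-true; dec-false; _×-dec_; _⊎-dec_; decidable-stable)
open import Relation.Unary using (Decidable)
open import Relation.Binary.Definitions using (Tri; tri<; tri≈; tri>)
open import Function using (case_of_; _∘_)
open import Relation.Binary.PropositionalEquality hiding ([_]; J)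
open import Data.List.Membership.Propositional using (_∈_; _∉_)
open import Data.List.Membership.Propositional.Properties
  using (∈-++⁻; ∈-++⁺ˡ; ∈-++⁺ʳ; ∈-map⁺; ∈-map⁻; ∈-upTo⁺; ∈-upTo⁻; ∈-filter⁺; ∈-filter⁻)
open import Data.List.Relation.Unary.Any using (here; there)
open import Data.List.Relation.Unary.All as All using (All; []; _∷_)
import Data.List.Relation.Unary.All.Properties as All
open import Data.List.Relation.Unary.AllPairs as AllPairs using (AllPairs; []; _∷_)
import Data.List.Relation.Unary.AllPairs.Properties as AllPairs
open import Data.List.Relation.Unary.Unique.Propositional using (Unique)
import Data.List.Relation.Unary.Unique.Propositional.Properties as Unique
open import Data.List.Relation.Binary.Permutation.Propositional
  using (_↭_; ↭-refl; ↭-sym; ↭-trans; ↭-reflexive; prep; ↭⇒↭ₛ)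
open import Data.List.Relation.Binary.Permutation.Propositional.Properties
  using (∈-resp-↭; All-resp-↭; shift; ++⁺; map⁺; ↭-reverse)
open import Data.List.Relation.Binary.Permutation.Setoid.Properties (setoid ℕ) using (Unique-resp-↭)

Prefix : List ℕ → List ℕ → Set
Prefix p q = ∃ λ r → q ≡ p ++ r

¬Prefix-∷ : ∀ {h} {p q : List ℕ} → ¬ Prefix (h ∷ p) (h ∷ q) → ¬ Prefix p q
¬Prefix-∷ np (r , eq) = np (r , cong (_ ∷_) eq)

StepsBelow : ℕ → List ℕ → List ℕ → Set
StepsBelow sy p q = ∀ j r → q ≡ p ++ j ∷ r → j ≤ sy

StepsBelow-∷ : ∀ {sy h} {p q : List ℕ} → StepsBelow sy (h ∷ p) (h ∷ q) → StepsBelow sy p q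
StepsBelow-∷ bd j r eq = bd j r (cong (_ ∷_) eq)

cmpPath-∷ : ∀ sy a py px → cmpPath sy (a ∷ py) (a ∷ px) ≡ cmpPath sy py px
cmpPath-∷ sy a py px rewrite dec-true (a ≟ a) refl = refl

cmpPath-left : ∀ sy a b py px → b < a → cmpPath sy (a ∷ py) (b ∷ px) ≡ 0
cmpPath-left sy a b py px b<a
  rewrite dec-false (a ≟ b) (≢-sym (<⇒≢ b<a)) | dec-true (b <? a) b<a = refl

cmpPath-right : ∀ sy a b py px → a < b → cmpPath sy (a ∷ py) (b ∷ px) ≡ sy
cmpPath-right sy a b py px a<b
  rewrite dec-false (a ≟ b) (<⇒≢ a<b) | dec-false (b <? a) (<-asym a<b) = refl

cmpPath-≤ : ∀ sy py px → StepsBelow sy py px → cmpPath sy py px ≤ sy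
cmpPath-≤ sy [] [] bd = z≤n
cmpPath-≤ sy [] (j ∷ px) bd = bd j px refl
cmpPath-≤ sy (a ∷ py) [] bd = z≤n
cmpPath-≤ sy (a ∷ py) (b ∷ px) bd with <-cmp a b
... | tri< a<b _ _ rewrite cmpPath-right sy a b py px a<b = ≤-refl
... | tri≈ _ refl _ rewrite cmpPath-∷ sy a py px = cmpPath-≤ sy py px (StepsBelow-∷ bd)
... | tri> _ _ b<a rewrite cmpPath-left sy a b py px b<a = z≤n

cmpPath-descendant : ∀ sy p j r → cmpPath sy p (p ++ j ∷ r) ≡ j
cmpPath-descendant sy [] j r = refl
cmpPath-descendant sy (a ∷ p) j r rewrite cmpPath-∷ sy a p (p ++ j ∷ r) = cmpPath-descendant sy p j r

cmpPath-++ʳ : ∀ sy p q r → ¬ Prefix q p → cmpPath sy p (q ++ r) ≡ cmpPath sy p q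
cmpPath-++ʳ sy p [] r np = ⊥-elim (np (p , refl))
cmpPath-++ʳ sy [] (j ∷ q) r np = refl
cmpPath-++ʳ sy (h ∷ p) (j ∷ q) r np with <-cmp h j
... | tri< h<j _ _ rewrite cmpPath-right sy h j p (q ++ r) h<j | cmpPath-right sy h j p q h<j = refl
... | tri≈ _ refl _ rewrite cmpPath-∷ sy h p (q ++ r) | cmpPath-∷ sy h p q = cmpPath-++ʳ sy p q r (¬Prefix-∷ np)
... | tri> _ _ j<h rewrite cmpPath-left sy h j p (q ++ r) j<h | cmpPath-left sy h j p q j<h = refl

cmpPath-inner : ∀ sy p q v → cmpPath sy p q ≡ v → v ≢ 0 → v ≢ sy → ∃ λ r → q ≡ p ++ v ∷ r
cmpPath-inner sy [] [] v e v≢0 v≢sy = ⊥-elim (v≢0 (sym e))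
cmpPath-inner sy [] (j ∷ q) v refl v≢0 v≢sy = q , refl
cmpPath-inner sy (h ∷ p) [] v e v≢0 v≢sy = ⊥-elim (v≢0 (sym e))
cmpPath-inner sy (h ∷ p) (j ∷ q) v e v≢0 v≢sy with <-cmp h j
... | tri< h<j _ _ rewrite cmpPath-right sy h j p q h<j = ⊥-elim (v≢sy (sym e))
... | tri> _ _ j<h rewrite cmpPath-left sy h j p q j<h = ⊥-elim (v≢0 (sym e))
... | tri≈ _ refl _ rewrite cmpPath-∷ sy h p q with cmpPath-inner sy p q v e v≢0 v≢sy
...   | r , refl = r , refl

cmpPath-transitive : ∀ sb sc pa pb pc → ¬ Prefix pb pc → ¬ Prefix pa pc → StepsBelow sc pc pb →
  cmpPath sb pb pa ≢ 0 → cmpPath sc pc pb ≤ cmpPath sc pc pa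
cmpPath-transitive sb sc pa [] pc npb npa bd nz = ⊥-elim (npb (pc , refl))
cmpPath-transitive sb sc [] (j ∷ pb) pc npb npa bd nz = ⊥-elim (npa (pc , refl))
cmpPath-transitive sb sc (k ∷ pa) (j ∷ pb) [] npb npa bd nz with <-cmp j k
... | tri< j<k _ _ = <⇒≤ j<k
... | tri≈ _ refl _ = ≤-refl
... | tri> _ _ k<j = ⊥-elim (nz (cmpPath-left sb j k pb pa k<j))
cmpPath-transitive sb sc (k ∷ pa) (j ∷ pb) (h ∷ pc) npb npa bd nz with <-cmp h j
... | tri> _ _ j<h rewrite cmpPath-left sc h j pc pb j<h = z≤n
... | tri< h<j _ _ rewrite cmpPath-right sc h j pc pb h<j with <-cmp j k
...   | tri< j<k _ _ rewrite cmpPath-right sc h k pc pa (<-trans h<j j<k) = ≤-refl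
...   | tri≈ _ refl _ rewrite cmpPath-right sc h j pc pa h<j = ≤-refl
...   | tri> _ _ k<j = ⊥-elim (nz (cmpPath-left sb j k pb pa k<j))
cmpPath-transitive sb sc (k ∷ pa) (j ∷ pb) (h ∷ pc) npb npa bd nz | tri≈ _ refl _ with <-cmp h k
... | tri< h<k _ _ rewrite cmpPath-∷ sc h pc pb | cmpPath-right sc h k pc pa h<k =
  cmpPath-≤ sc pc pb (StepsBelow-∷ bd)
... | tri≈ _ refl _ rewrite cmpPath-∷ sc h pc pb | cmpPath-∷ sc h pc pa | cmpPath-∷ sb h pb pa =
  cmpPath-transitive sb sc pa pb pc (¬Prefix-∷ npb) (¬Prefix-∷ npa) (StepsBelow-∷ bd) nz
... | tri> _ _ k<h = ⊥-elim (nz (cmpPath-left sb h k pb pa k<h))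

cmpPath-planar : ∀ sb sc pa pb pc → ¬ Prefix pb pc → StepsBelow sc pc pa →
  0 < cmpPath sc pc pa → (cmpPath sb pb pa ≡ sb) ⊎ (cmpPath sc pc pa ≤ cmpPath sc pc pb)
cmpPath-planar sb sc pa [] pc npb bd pos = ⊥-elim (npb (pc , refl))
cmpPath-planar sb sc [] (j ∷ pb) [] npb bd ()
cmpPath-planar sb sc [] (j ∷ pb) (h ∷ pc) npb bd ()
cmpPath-planar sb sc (k ∷ pa) (j ∷ pb) [] npb bd pos with <-cmp j k
... | tri< j<k _ _ = inj₁ (cmpPath-right sb j k pb pa j<k)
... | tri≈ _ refl _ = inj₂ ≤-refl
... | tri> _ _ k<j = inj₂ (<⇒≤ k<j)
cmpPath-planar sb sc (k ∷ pa) (j ∷ pb) (h ∷ pc) npb bd pos with <-cmp h k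
... | tri> _ _ k<h rewrite cmpPath-left sc h k pc pa k<h with pos
...   | ()
cmpPath-planar sb sc (k ∷ pa) (j ∷ pb) (h ∷ pc) npb bd pos | tri< h<k _ _
  rewrite cmpPath-right sc h k pc pa h<k with <-cmp h j
... | tri< h<j _ _ rewrite cmpPath-right sc h j pc pb h<j = inj₂ ≤-refl
... | tri≈ _ refl _ = inj₁ (cmpPath-right sb h k pb pa h<k)
... | tri> _ _ j<h = inj₁ (cmpPath-right sb j k pb pa (<-trans j<h h<k))
cmpPath-planar sb sc (k ∷ pa) (j ∷ pb) (h ∷ pc) npb bd pos | tri≈ _ refl _ with <-cmp h j
... | tri< h<j _ _ rewrite cmpPath-∷ sc h pc pa | cmpPath-right sc h j pc pb h<j =
  inj₂ (cmpPath-≤ sc pc pa (StepsBelow-∷ bd))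
... | tri≈ _ refl _ rewrite cmpPath-∷ sc h pc pb | cmpPath-∷ sc h pc pa | cmpPath-∷ sb h pb pa =
  cmpPath-planar sb sc pa pb pc (¬Prefix-∷ npb) (StepsBelow-∷ bd) pos
... | tri> _ _ j<h = inj₁ (cmpPath-right sb j h pb pa j<h)

mutual
  at : Tree → List ℕ → Maybe Tree
  at t [] = just t
  at leaf (j ∷ p) = nothing
  at (node i cs) (j ∷ p) = atChild j cs p

  atChild : ℕ → List Tree → List ℕ → Maybe Tree
  atChild j [] p = nothing
  atChild zero (c ∷ cs) p = at c p
  atChild (suc j) (c ∷ cs) p = atChild j cs p

pathTo-root : ∀ i cs → pathTo (node i cs) i ≡ just []
pathTo-root i cs rewrite dec-true (i ≟ i) refl = refl

pathTo-node : ∀ i cs x → i ≢ x → pathTo (node i cs) x ≡ pathToL 0 cs x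
pathTo-node i cs x i≢x rewrite dec-false (i ≟ x) i≢x = refl

mutual
  pathTo⇒at : ∀ t x p → pathTo t x ≡ just p → ∃ λ cs → at t p ≡ just (node x cs)
  pathTo⇒at leaf x p ()
  pathTo⇒at (node i cs) x p eq with i ≟ x
  ... | yes refl rewrite pathTo-root i cs with eq
  ...   | refl = cs , refl
  pathTo⇒at (node i cs) x p eq | no i≢x rewrite pathTo-node i cs x i≢x with pathToL⇒atChild 0 cs x p eq
  ... | j , q , cs' , refl , e rewrite +-identityʳ j = cs' , e

  pathToL⇒atChild : ∀ k cs x p → pathToL k cs x ≡ just p →
    ∃ λ j → ∃ λ q → ∃ λ cs' → (p ≡ (j + k) ∷ q) × (atChild j cs q ≡ just (node x cs'))
  pathToL⇒atChild k [] x p ()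
  pathToL⇒atChild k (c ∷ cs) x p eq with pathTo c x in e
  ... | just q with eq
  ...   | refl = 0 , q , proj₁ (pathTo⇒at c x q e) , refl , proj₂ (pathTo⇒at c x q e)
  pathToL⇒atChild k (c ∷ cs) x p eq | nothing with pathToL⇒atChild (suc k) cs x p eq
  ... | j , q , cs' , refl , e' = suc j , q , cs' , cong (_∷ q) (+-suc j k) , e'

mutual
  ∈labels⇒pathTo : ∀ t x → x ∈ labels t → ∃ λ p → pathTo t x ≡ just p
  ∈labels⇒pathTo leaf x ()
  ∈labels⇒pathTo (node i cs) x m with i ≟ x
  ... | yes refl = [] , pathTo-root i cs
  ... | no i≢x with m
  ...   | here x≡i = ⊥-elim (i≢x (sym x≡i))
  ...   | there m' rewrite pathTo-node i cs x i≢x = ∈labelsL⇒pathToL 0 cs x m'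

  ∈labelsL⇒pathToL : ∀ k cs x → x ∈ labelsL cs → ∃ λ p → pathToL k cs x ≡ just p
  ∈labelsL⇒pathToL k [] x ()
  ∈labelsL⇒pathToL k (c ∷ cs) x m with pathTo c x in e
  ... | just q = k ∷ q , refl
  ... | nothing with ∈-++⁻ (labels c) m
  ...   | inj₂ m₂ = ∈labelsL⇒pathToL (suc k) cs x m₂
  ...   | inj₁ m₁ with ∈labels⇒pathTo c x m₁
  ...     | q , e' with () ← trans (sym e) e'

mutual
  at⇒∈labels : ∀ t q x cs → at t q ≡ just (node x cs) → x ∈ labels t
  at⇒∈labels t [] x cs refl = here refl
  at⇒∈labels leaf (j ∷ q) x cs ()
  at⇒∈labels (node i cs') (j ∷ q) x cs e = there (proj₁ (atChild⇒∈labelsL j cs' q x cs e))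

  atChild⇒∈labelsL : ∀ j cs q x cs' → atChild j cs q ≡ just (node x cs') → (x ∈ labelsL cs) × (j < length cs)
  atChild⇒∈labelsL j [] q x cs' ()
  atChild⇒∈labelsL zero (c ∷ cs) q x cs' e = ∈-++⁺ˡ (at⇒∈labels c q x cs' e) , s≤s z≤n
  atChild⇒∈labelsL (suc j) (c ∷ cs) q x cs' e with atChild⇒∈labelsL j cs q x cs' e
  ... | m , l = ∈-++⁺ʳ (labels c) m , s≤s l

mutual
  at-++ : ∀ t p r u → at t p ≡ just u → at t (p ++ r) ≡ at u r
  at-++ t [] r u refl = refl
  at-++ leaf (j ∷ p) r u ()
  at-++ (node i cs) (j ∷ p) r u e = atChild-++ j cs p r u e

  atChild-++ : ∀ j cs p r u → atChild j cs p ≡ just u → atChild j cs (p ++ r) ≡ at u r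
  atChild-++ j [] p r u ()
  atChild-++ zero (c ∷ cs) p r u e = at-++ c p r u e
  atChild-++ (suc j) (c ∷ cs) p r u e = atChild-++ j cs p r u e

mutual
  at-Decreasing : ∀ s t p u → Decreasing s t → at t p ≡ just u → Decreasing s u
  at-Decreasing s t [] u d refl = d
  at-Decreasing s leaf (j ∷ p) u d ()
  at-Decreasing s (node i cs) (j ∷ p) u (_ , _ , d) e = atChild-Decreasing s j cs p u d e

  atChild-Decreasing : ∀ s j cs p u → DecreasingL s cs → atChild j cs p ≡ just u → Decreasing s u
  atChild-Decreasing s j [] p u d ()
  atChild-Decreasing s zero (c ∷ cs) p u (d , _) e = at-Decreasing s c p u d e
  atChild-Decreasing s (suc j) (c ∷ cs) p u (_ , d) e = atChild-Decreasing s j cs p u d e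

Decreasing-descendant : ∀ s t p y cs j q x cs' → Decreasing s t → at t p ≡ just (node y cs) →
  at t (p ++ j ∷ q) ≡ just (node x cs') → (x < y) × (j ≤ s y)
Decreasing-descendant s t p y cs j q x cs' d e₁ e₂ with at-Decreasing s t p _ d e₁
... | len , below , _ rewrite at-++ t p (j ∷ q) _ e₁ with atChild⇒∈labelsL j cs q x cs' e₂
... | m , l = All.lookup below m , ≤-pred (subst (j <_) len l)

at-prefix : ∀ t p j q u → at t (p ++ j ∷ q) ≡ just u → ∃ λ e → ∃ λ cs → at t p ≡ just (node e cs)
at-prefix leaf [] j q u ()
at-prefix (node i cs) [] j q u e = i , cs , refl
at-prefix leaf (h ∷ p) j q u ()
at-prefix (node i cs) (h ∷ p) j q u e = atChild-prefix h cs e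
  where
  atChild-prefix : ∀ h cs → atChild h cs (p ++ j ∷ q) ≡ just u → ∃ λ e → ∃ λ cs' → atChild h cs p ≡ just (node e cs')
  atChild-prefix h [] ()
  atChild-prefix zero (c ∷ cs) e = at-prefix c p j q u e
  atChild-prefix (suc h) (c ∷ cs) e = atChild-prefix h cs e

nth⇒atChild : ∀ j cs c q → nth j cs ≡ just c → atChild j cs q ≡ at c q
nth⇒atChild j [] c q ()
nth⇒atChild zero (c' ∷ cs) c q refl = refl
nth⇒atChild (suc j) (c' ∷ cs) c q e = nth⇒atChild j cs c q e

Unique-++⁻ : (xs : List ℕ) {ys : List ℕ} → Unique (xs ++ ys) → Unique xs × Unique ys × (∀ {e} → e ∈ xs → e ∉ ys)
Unique-++⁻ [] u = [] , u , λ ()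
Unique-++⁻ (x ∷ xs) (x∉ ∷ u) with Unique-++⁻ xs u
... | u₁ , u₂ , disj = All.++⁻ˡ xs x∉ ∷ u₁ , u₂ ,
  λ { (here refl) m → All.lookup (All.++⁻ʳ xs x∉) m refl ; (there m₁) m → disj m₁ m }

mutual
  at-injective : ∀ t p q e cs₁ cs₂ → Unique (labels t) → at t p ≡ just (node e cs₁) →
    at t q ≡ just (node e cs₂) → p ≡ q
  at-injective t [] [] e cs₁ cs₂ u e₁ e₂ = refl
  at-injective leaf [] (k ∷ q) e cs₁ cs₂ u () e₂
  at-injective (node i cs) [] (k ∷ q) e cs₁ cs₂ (i∉ ∷ u) refl e₂ =
    ⊥-elim (All.lookup i∉ (proj₁ (atChild⇒∈labelsL k cs q e cs₂ e₂)) refl)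
  at-injective leaf (j ∷ p) q e cs₁ cs₂ u () e₂
  at-injective (node i cs) (j ∷ p) [] e cs₁ cs₂ (i∉ ∷ u) e₁ refl =
    ⊥-elim (All.lookup i∉ (proj₁ (atChild⇒∈labelsL j cs p e cs₁ e₁)) refl)
  at-injective (node i cs) (j ∷ p) (k ∷ q) e cs₁ cs₂ (_ ∷ u) e₁ e₂
    with atChild-injective j k cs p q e cs₁ cs₂ u e₁ e₂
  ... | refl , refl = refl

  atChild-injective : ∀ j k cs p q e cs₁ cs₂ → Unique (labelsL cs) → atChild j cs p ≡ just (node e cs₁) →
    atChild k cs q ≡ just (node e cs₂) → (j ≡ k) × (p ≡ q)
  atChild-injective j k [] p q e cs₁ cs₂ u () e₂
  atChild-injective zero zero (c ∷ cs) p q e cs₁ cs₂ u e₁ e₂ =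
    refl , at-injective c p q e cs₁ cs₂ (proj₁ (Unique-++⁻ (labels c) u)) e₁ e₂
  atChild-injective zero (suc k) (c ∷ cs) p q e cs₁ cs₂ u e₁ e₂ =
    ⊥-elim (proj₂ (proj₂ (Unique-++⁻ (labels c) u)) (at⇒∈labels c p e cs₁ e₁) (proj₁ (atChild⇒∈labelsL k cs q e cs₂ e₂)))
  atChild-injective (suc j) zero (c ∷ cs) p q e cs₁ cs₂ u e₁ e₂ =
    ⊥-elim (proj₂ (proj₂ (Unique-++⁻ (labels c) u)) (at⇒∈labels c q e cs₂ e₂) (proj₁ (atChild⇒∈labelsL j cs p e cs₁ e₁)))
  atChild-injective (suc j) (suc k) (c ∷ cs) p q e cs₁ cs₂ u e₁ e₂
    with atChild-injective j k cs p q e cs₁ cs₂ (proj₁ (proj₂ (Unique-++⁻ (labels c) u))) e₁ e₂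
  ... | refl , refl = refl , refl

mutual
  pathTo≡nothing⇒subtree≡nothing : ∀ t x → pathTo t x ≡ nothing → subtree t x ≡ nothing
  pathTo≡nothing⇒subtree≡nothing leaf x e = refl
  pathTo≡nothing⇒subtree≡nothing (node i cs) x e with i ≟ x
  ... | yes refl rewrite pathTo-root i cs with () ← e
  ... | no i≢x rewrite dec-false (i ≟ x) i≢x = pathToL≡nothing⇒subtreeL≡nothing 0 cs x e

  pathToL≡nothing⇒subtreeL≡nothing : ∀ k cs x → pathToL k cs x ≡ nothing → subtreeL cs x ≡ nothing
  pathToL≡nothing⇒subtreeL≡nothing k [] x e = refl
  pathToL≡nothing⇒subtreeL≡nothing k (c ∷ cs) x e with pathTo c x in e₁
  ... | nothing rewrite pathTo≡nothing⇒subtree≡nothing c x e₁ = pathToL≡nothing⇒subtreeL≡nothing (suc k) cs x e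
  ... | just q with () ← e

mutual
  subtree≡at : ∀ t x p → pathTo t x ≡ just p → subtree t x ≡ at t p
  subtree≡at leaf x p ()
  subtree≡at (node i cs) x p e with i ≟ x
  ... | yes refl rewrite pathTo-root i cs | dec-true (i ≟ i) refl with e
  ...   | refl = refl
  subtree≡at (node i cs) x p e | no i≢x rewrite dec-false (i ≟ x) i≢x with subtreeL≡atChild 0 cs x p e
  ... | j , q , refl , e₂ rewrite +-identityʳ j = e₂

  subtreeL≡atChild : ∀ k cs x p → pathToL k cs x ≡ just p →
    ∃ λ j → ∃ λ q → (p ≡ (j + k) ∷ q) × (subtreeL cs x ≡ atChild j cs q)
  subtreeL≡atChild k [] x p ()
  subtreeL≡atChild k (c ∷ cs) x p e with pathTo c x in e₁
  ... | just q with e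
  ...   | refl with pathTo⇒at c x q e₁
  ...     | cs' , ea rewrite subtree≡at c x q e₁ | ea = 0 , q , refl , sym ea
  subtreeL≡atChild k (c ∷ cs) x p e | nothing rewrite pathTo≡nothing⇒subtree≡nothing c x e₁
    with subtreeL≡atChild (suc k) cs x p e
  ... | j , q , refl , e₂ = suc j , q , cong (_∷ q) (+-suc j k) , e₂

under⇒descendant : ∀ p q j → under p q ≡ just j → ∃ λ r → q ≡ p ++ j ∷ r
under⇒descendant [] [] j ()
under⇒descendant [] (k ∷ q) j refl = q , refl
under⇒descendant (a ∷ p) [] j ()
under⇒descendant (a ∷ p) (b ∷ q) j e with a ≟ b
... | no a≢b rewrite dec-false (a ≟ b) a≢b with () ← e
... | yes refl rewrite dec-true (a ≟ a) refl with under⇒descendant p q j e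
...   | r , refl = r , refl

under-descendant : ∀ p j r → under p (p ++ j ∷ r) ≡ just j
under-descendant [] j r = refl
under-descendant (a ∷ p) j r rewrite dec-true (a ≟ a) refl = under-descendant p j r

childIdx⇒pathTo : ∀ T e x j → childIdx T e x ≡ just j →
  ∃ λ pe → ∃ λ r → (pathTo T e ≡ just pe) × (pathTo T x ≡ just (pe ++ j ∷ r))
childIdx⇒pathTo T e x j ci with pathTo T e | pathTo T x
... | just pe | just px with under⇒descendant pe px j ci
...   | r , refl = pe , r , refl , refl

pathTo⇒childIdx : ∀ T e x pe j r → pathTo T e ≡ just pe → pathTo T x ≡ just (pe ++ j ∷ r) →
  childIdx T e x ≡ just j
pathTo⇒childIdx T e x pe j r ee ex with pathTo T e | pathTo T x
pathTo⇒childIdx T e x pe j r refl refl | _ | _ = under-descendant pe j r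

Labelled : ℕ → ℕ → Set
Labelled n x = (1 ≤ x) × (x ≤ n)

labels-Unique : ∀ s n T → IsSDecTree s n T → Unique (labels T)
labels-Unique s n T (perm , _) =
  Unique-resp-↭ (↭⇒↭ₛ (↭-sym perm)) (Unique.map⁺ suc-injective (Unique.upTo⁺ n))

labelled⇒pathTo : ∀ s n T x → IsSDecTree s n T → Labelled n x → ∃ λ p → pathTo T x ≡ just p
labelled⇒pathTo s n T (suc x) (perm , _) (_ , x<n) =
  ∈labels⇒pathTo T (suc x) (∈-resp-↭ (↭-sym perm) (∈-map⁺ suc (∈-upTo⁺ x<n)))

at⇒pathTo : ∀ s n T p e cs → IsSDecTree s n T → at T p ≡ just (node e cs) → pathTo T e ≡ just p
at⇒pathTo s n T p e cs sd ea with ∈labels⇒pathTo T e (at⇒∈labels T p e cs ea)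
... | p' , ep with pathTo⇒at T e p' ep
... | cs' , ea' rewrite at-injective T p' p e cs' cs (labels-Unique s n T sd) ea' ea = ep

smaller⇒¬ancestor : ∀ s T b c pb pc → Decreasing s T → pathTo T b ≡ just pb → pathTo T c ≡ just pc →
  b < c → ¬ Prefix pb pc
smaller⇒¬ancestor s T b c pb pc d eb ec b<c (r , refl) with pathTo⇒at T b pb eb | pathTo⇒at T c (pb ++ r) ec
... | csb , ab | csc , ac with r
... | [] rewrite ++-identityʳ pb with refl ← trans (sym ab) ac = <-irrefl refl b<c
... | j ∷ q = <-asym b<c (proj₁ (Decreasing-descendant s T pb b csb j q c csc d ab ac))

pathTo-StepsBelow : ∀ s T y x py px → Decreasing s T → pathTo T y ≡ just py → pathTo T x ≡ just px →
  StepsBelow (s y) py px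
pathTo-StepsBelow s T y x py px d ey ex j r refl with pathTo⇒at T y py ey | pathTo⇒at T x (py ++ j ∷ r) ex
... | csy , ay | csx , ax = proj₂ (Decreasing-descendant s T py y csy j r x csx d ay ax)

inv-pathTo : ∀ s T y x py px → pathTo T y ≡ just py → pathTo T x ≡ just px →
  inv s T y x ≡ cmpPath (s y) py px
inv-pathTo s T y x py px ey ex rewrite ey | ex = refl

inv-childIdx : ∀ s T e x j → childIdx T e x ≡ just j → inv s T e x ≡ j
inv-childIdx s T e x j ci with childIdx⇒pathTo T e x j ci
... | pe , r , ee , ex rewrite inv-pathTo s T e x pe (pe ++ j ∷ r) ee ex = cmpPath-descendant (s e) pe j r

Planar : (ℕ → ℕ) → ℕ → Multiset → Set
Planar s n I = ∀ a b c → 1 ≤ a → a < b → b < c → c ≤ n →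
  0 < I c a → (I b a ≡ s b) ⊎ (I c a ≤ I c b)

Bounded : (ℕ → ℕ) → ℕ → Multiset → Set
Bounded s n I = ∀ y x → Pair n y x → I y x ≤ s y

record IsTreeInversions (s : ℕ → ℕ) (n : ℕ) (I : Multiset) : Set where
  field
    transitive : Transitive n I
    planar : Planar s n I
    bounded : Bounded s n I

module _ (s : ℕ → ℕ) (n : ℕ) (T : Tree) (sd : IsSDecTree s n T) where

  private
    dec : Decreasing s T
    dec = proj₂ sd

    triple : ∀ a b c → 1 ≤ a → a < b → b < c → c ≤ n →
      ∃ λ pa → ∃ λ pb → ∃ λ pc → (pathTo T a ≡ just pa) × (pathTo T b ≡ just pb) × (pathTo T c ≡ just pc)
    triple a b c 1≤a a<b b<c c≤n with labelled⇒pathTo s n T a sd (1≤a , ≤-trans (<⇒≤ (<-trans a<b b<c)) c≤n)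
      | labelled⇒pathTo s n T b sd (≤-trans 1≤a (<⇒≤ a<b) , ≤-trans (<⇒≤ b<c) c≤n)
      | labelled⇒pathTo s n T c sd (≤-trans 1≤a (<⇒≤ (<-trans a<b b<c)) , c≤n)
    ... | pa , ea | pb , eb | pc , ec = pa , pb , pc , ea , eb , ec

  inv-transitive : Transitive n (inv s T)
  inv-transitive a b c 1≤a a<b b<c c≤n with triple a b c 1≤a a<b b<c c≤n
  ... | pa , pb , pc , ea , eb , ec
    rewrite inv-pathTo s T b a pb pa eb ea | inv-pathTo s T c b pc pb ec eb | inv-pathTo s T c a pc pa ec ea
    with cmpPath (s b) pb pa ≟ 0
  ... | yes z = inj₁ z
  ... | no nz = inj₂ (cmpPath-transitive (s b) (s c) pa pb pc
    (smaller⇒¬ancestor s T b c pb pc dec eb ec b<c)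
    (smaller⇒¬ancestor s T a c pa pc dec ea ec (<-trans a<b b<c))
    (pathTo-StepsBelow s T c b pc pb dec ec eb) nz)

  inv-planar : Planar s n (inv s T)
  inv-planar a b c 1≤a a<b b<c c≤n with triple a b c 1≤a a<b b<c c≤n
  ... | pa , pb , pc , ea , eb , ec
    rewrite inv-pathTo s T b a pb pa eb ea | inv-pathTo s T c b pc pb ec eb | inv-pathTo s T c a pc pa ec ea
    = cmpPath-planar (s b) (s c) pa pb pc (smaller⇒¬ancestor s T b c pb pc dec eb ec b<c)
        (pathTo-StepsBelow s T c a pc pa dec ec ea)

  inv-bounded : Bounded s n (inv s T)
  inv-bounded y x (1≤x , x<y , y≤n) with labelled⇒pathTo s n T x sd (1≤x , ≤-trans (<⇒≤ x<y) y≤n)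
    | labelled⇒pathTo s n T y sd (≤-trans 1≤x (<⇒≤ x<y) , y≤n)
  ... | px , ex | py , ey rewrite inv-pathTo s T y x py px ey ex =
    cmpPath-≤ (s y) py px (pathTo-StepsBelow s T y x py px dec ey ex)

  inv-IsTreeInversions : IsTreeInversions s n (inv s T)
  inv-IsTreeInversions = record
    { transitive = inv-transitive ; planar = inv-planar ; bounded = inv-bounded }

filter-↭-++ : {P Q R : ℕ → Set} (P? : Decidable P) (Q? : Decidable Q) (R? : Decidable R) →
  (∀ {x} → R x → P x ⊎ Q x) → (∀ {x} → P x ⊎ Q x → R x) → (∀ {x} → P x → ¬ Q x) →
  ∀ xs → filter R? xs ↭ filter P? xs ++ filter Q? xs
filter-↭-++ P? Q? R? R⇒P⊎Q P⊎Q⇒R disjoint [] = ↭-refl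
filter-↭-++ P? Q? R? R⇒P⊎Q P⊎Q⇒R disjoint (x ∷ xs) with ih ← filter-↭-++ P? Q? R? R⇒P⊎Q P⊎Q⇒R disjoint xs
  | P? x | Q? x | R? x
... | yes p | yes q | _ = ⊥-elim (disjoint p q)
... | yes p | no _ | yes _ = prep x ih
... | no _ | yes q | yes _ = ↭-trans (prep x ih) (↭-sym (shift x _ _))
... | no _ | no _ | no _ = ih
... | yes p | no _ | no ¬r = ⊥-elim (¬r (P⊎Q⇒R (inj₁ p)))
... | no _ | yes q | no ¬r = ⊥-elim (¬r (P⊎Q⇒R (inj₂ q)))
... | no ¬p | no ¬q | yes r = ⊥-elim ([ ¬p , ¬q ] (R⇒P⊎Q r))

-- Every multiset satisfying the inversion axioms is inv of an s-decreasing tree: the root is the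
-- largest label m, and its child j is built recursively from the labels x with J m x ≡ j.
module Realisation (s : ℕ → ℕ) (n : ℕ) (J : Multiset) (JI : IsTreeInversions s n J) where

  open IsTreeInversions JI

  InRange : ℕ → ℕ → ℕ → ℕ → Set
  InRange m k N x = (k ≤ J m x) × (J m x < k + N)

  inRange? : ∀ m k N → Decidable (InRange m k N)
  inRange? m k N x = (k ≤? J m x) ×-dec (J m x <? k + N)

  childOf? : ∀ m j → Decidable (λ x → J m x ≡ j)
  childOf? m j x = J m x ≟ j

  mutual
    -- the fuel f must be at least the length of the list
    build : ℕ → List ℕ → Tree
    build zero _ = leaf
    build (suc f) [] = leaf
    build (suc f) (m ∷ rest) = node m (children f m rest 0 (suc (s m)))

    children : ℕ → ℕ → List ℕ → ℕ → ℕ → List Tree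
    children f m rest k zero = []
    children f m rest k (suc N) = build f (filter (childOf? m k) rest) ∷ children f m rest (suc k) N

  Admissible : List ℕ → Set
  Admissible L = AllPairs _>_ L × All (Labelled n) L

  filter-Admissible : ∀ {P : ℕ → Set} (P? : Decidable P) {L} → Admissible L → Admissible (filter P? L)
  filter-Admissible P? (desc , lab) = AllPairs.filter⁺ P? desc , All.filter⁺ P? lab

  root-bounded : ∀ {m rest} → Admissible (m ∷ rest) → All (λ x → J m x < suc (s m)) rest
  root-bounded ((m>rest ∷ _) , (1≤m , m≤n) ∷ lab) =
    All.zipWith (λ { (x<m , (1≤x , _)) → s≤s (bounded _ _ (1≤x , x<m , m≤n)) }) (m>rest , lab)

  InRange-suc : ∀ m k N {x} → InRange m k (suc N) x → (J m x ≡ k) ⊎ InRange m (suc k) N x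
  InRange-suc m k N {x} (k≤J , J<) with J m x ≟ k
  ... | yes e = inj₁ e
  ... | no ne = inj₂ (≤∧≢⇒< k≤J (≢-sym ne) , subst (J m x <_) (+-suc k N) J<)

  mutual
    labels-build : ∀ f L → length L ≤ f → Admissible L → labels (build f L) ↭ L
    labels-build zero [] _ _ = ↭-refl
    labels-build (suc f) [] _ _ = ↭-refl
    labels-build (suc f) (m ∷ rest) (s≤s len) adm@((_ ∷ desc) , (_ ∷ lab)) =
      prep m (↭-trans (labels-children f m rest 0 (suc (s m)) len (desc , lab))
        (↭-reflexive (filter-all (inRange? m 0 (suc (s m))) (All.map (z≤n ,_) (root-bounded adm)))))

    labels-children : ∀ f m rest k N → length rest ≤ f → Admissible rest →
      labelsL (children f m rest k N) ↭ filter (inRange? m k N) rest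
    labels-children f m rest k zero len adm = ↭-reflexive (sym (filter-none (inRange? m k 0)
      (All.tabulate {xs = rest} λ {x} _ (k≤J , J<k) → <⇒≱ (subst (J m x <_) (+-identityʳ k) J<k) k≤J)))
    labels-children f m rest k (suc N) len adm =
      ↭-trans (++⁺ (labels-build f _ (≤-trans (length-filter _ rest) len) (filter-Admissible _ adm))
                   (labels-children f m rest (suc k) N len adm))
              (↭-sym (filter-↭-++ (childOf? m k) (inRange? m (suc k) N) (inRange? m k (suc N))
                (InRange-suc m k N)
                (λ {x} → [ (λ e → ≤-reflexive (sym e) , subst (_< k + suc N) (sym e) (m<m+n k (s≤s z≤n)))
                , (λ { (k<J , J<) → <⇒≤ k<J , subst (J m x <_) (sym (+-suc k N)) J< }) ])
                (λ { e (k<J , _) → <-irrefl (sym e) k<J }) rest))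

  mutual
    build-Decreasing : ∀ f L → length L ≤ f → Admissible L → Decreasing s (build f L)
    build-Decreasing zero [] _ _ = tt
    build-Decreasing (suc f) [] _ _ = tt
    build-Decreasing (suc f) (m ∷ rest) (s≤s len) ((m>rest ∷ desc) , (_ ∷ lab)) =
      length-children f m rest 0 (suc (s m)) ,
      All-resp-↭ (↭-sym (labels-children f m rest 0 (suc (s m)) len (desc , lab))) (All.filter⁺ _ m>rest) ,
      children-Decreasing f m rest 0 (suc (s m)) len (desc , lab)

    children-Decreasing : ∀ f m rest k N → length rest ≤ f → Admissible rest →
      DecreasingL s (children f m rest k N)
    children-Decreasing f m rest k zero len adm = tt
    children-Decreasing f m rest k (suc N) len adm =
      build-Decreasing f _ (≤-trans (length-filter _ rest) len) (filter-Admissible _ adm) ,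
      children-Decreasing f m rest (suc k) N len adm

    length-children : ∀ f m rest k N → length (children f m rest k N) ≡ N
    length-children f m rest k zero = refl
    length-children f m rest k (suc N) = cong suc (length-children f m rest (suc k) N)

  ∉labels⇒pathTo : ∀ t x → x ∉ labels t → pathTo t x ≡ nothing
  ∉labels⇒pathTo t x x∉ with pathTo t x in e
  ... | nothing = refl
  ... | just p = ⊥-elim (x∉ (at⇒∈labels t p x _ (proj₂ (pathTo⇒at t x p e))))

  pathTo-children : ∀ f m rest k N x → length rest ≤ f → Admissible rest → x ∈ rest → InRange m k N x →
    ∃ λ p → (pathToL k (children f m rest k N) x ≡ just (J m x ∷ p)) ×
            (pathTo (build f (filter (childOf? m (J m x)) rest)) x ≡ just p)
  pathTo-children f m rest k zero x len adm x∈ (k≤J , J<k) =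
    ⊥-elim (<⇒≱ (subst (J m x <_) (+-identityʳ k) J<k) k≤J)
  pathTo-children f m rest k (suc N) x len adm x∈ range
    with labels-build f (filter (childOf? m k) rest) (≤-trans (length-filter (childOf? m k) rest) len)
           (filter-Admissible (childOf? m k) adm)
  ... | labs with InRange-suc m k N range
  ... | inj₁ refl with ∈labels⇒pathTo _ x (∈-resp-↭ (↭-sym labs) (∈-filter⁺ (childOf? m k) x∈ refl))
  ...   | p , e rewrite e = p , refl , refl
  pathTo-children f m rest k (suc N) x len adm x∈ range | labs | inj₂ range'
    rewrite ∉labels⇒pathTo _ x
      (λ x∈c → <-irrefl (sym (proj₂ (∈-filter⁻ (childOf? m k) {xs = rest} (∈-resp-↭ labs x∈c)))) (proj₁ range')) =
    pathTo-children f m rest (suc k) N x len adm x∈ range'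

  pathTo-build : ∀ f m rest x → length rest ≤ f → Admissible (m ∷ rest) → x ∈ rest →
    ∃ λ p → (pathTo (build (suc f) (m ∷ rest)) x ≡ just (J m x ∷ p)) ×
            (pathTo (build f (filter (childOf? m (J m x)) rest)) x ≡ just p)
  pathTo-build f m rest x len adm@((m>rest ∷ desc) , (_ ∷ lab)) x∈
    rewrite pathTo-node m (children f m rest 0 (suc (s m))) x (≢-sym (<⇒≢ (All.lookup m>rest x∈))) =
    pathTo-children f m rest 0 (suc (s m)) x len (desc , lab) x∈ (z≤n , All.lookup (root-bounded adm) x∈)

  inv-build : ∀ f L → length L ≤ f → Admissible L →
    ∀ y x → y ∈ L → x ∈ L → x < y → inv s (build f L) y x ≡ J y x
  inv-build (suc f) (m ∷ rest) len ((m>rest ∷ _) , _) y x y∈ (here refl) x<y with y∈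
  ... | here refl = ⊥-elim (<-irrefl refl x<y)
  ... | there y∈rest = ⊥-elim (<-asym x<y (All.lookup m>rest y∈rest))
  inv-build (suc f) (m ∷ rest) (s≤s len) adm y x (here refl) (there x∈) x<y
    with pathTo-build f m rest x len adm x∈
  ... | p , ex , _ = inv-pathTo s (build (suc f) (m ∷ rest)) m x [] (J m x ∷ p)
    (pathTo-root m (children f m rest 0 (suc (s m)))) ex
  inv-build (suc f) (m ∷ rest) (s≤s len) adm y x (there y∈) (there x∈) x<y
    with pathTo-build f m rest x len adm x∈ | pathTo-build f m rest y len adm y∈
  ... | px , ex , cx | py , ey , cy
    rewrite inv-pathTo s (build (suc f) (m ∷ rest)) y x (J m y ∷ py) (J m x ∷ px) ey ex =
    inv-siblings (<-cmp (J m y) (J m x))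
    where
    m>rest : All (m >_) rest
    m>rest = AllPairs.head (proj₁ adm)
    lab : All (Labelled n) (m ∷ rest)
    lab = proj₂ adm
    triangle : 1 ≤ x × x < y × y < m × m ≤ n
    triangle = proj₁ (All.lookup (All.tail lab) x∈) , x<y , All.lookup m>rest y∈ , proj₂ (All.head lab)

    inv-siblings : Tri (J m y < J m x) (J m y ≡ J m x) (J m x < J m y) →
      cmpPath (s y) (J m y ∷ py) (J m x ∷ px) ≡ J y x
    inv-siblings (tri< jy<jx _ _) rewrite cmpPath-right (s y) _ (J m x) py px jy<jx
      with (1≤x , x<y , y<m , m≤n) ← triangle
      with planar x y m 1≤x x<y y<m m≤n (≤-<-trans z≤n jy<jx)
    ... | inj₁ e = sym e
    ... | inj₂ jx≤jy = ⊥-elim (<⇒≱ jy<jx jx≤jy)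
    inv-siblings (tri> _ _ jx<jy) rewrite cmpPath-left (s y) _ (J m x) py px jx<jy
      with (1≤x , x<y , y<m , m≤n) ← triangle
      with transitive x y m 1≤x x<y y<m m≤n
    ... | inj₁ e = sym e
    ... | inj₂ jy≤jx = ⊥-elim (<⇒≱ jx<jy jy≤jx)
    inv-siblings (tri≈ _ jy≡jx _) rewrite jy≡jx | cmpPath-∷ (s y) (J m x) py px = begin
      cmpPath (s y) py px        ≡⟨ sym (inv-pathTo s (build f (filter col? rest)) y x py px cy' cx) ⟩
      inv s (build f (filter col? rest)) y x
        ≡⟨ inv-build f (filter col? rest) (≤-trans (length-filter col? rest) len)
             (filter-Admissible col? (AllPairs.tail (proj₁ adm) , All.tail lab))
             y x (∈-filter⁺ col? y∈ jy≡jx) (∈-filter⁺ col? x∈ refl) x<y ⟩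
      J y x                      ∎
      where
      open ≡-Reasoning
      col? : Decidable (λ z → J m z ≡ J m x)
      col? = childOf? m (J m x)
      cy' : pathTo (build f (filter col? rest)) y ≡ just py
      cy' = subst (λ j → pathTo (build f (filter (childOf? m j) rest)) y ≡ just py) jy≡jx cy

realise : ∀ s n J → IsTreeInversions s n J →
  ∃ λ U → IsSDecTree s n U × (∀ y x → Pair n y x → inv s U y x ≡ J y x)
realise s n J JI =
  build n L ,
  (↭-trans (labels-build n L len adm) L↭ , build-Decreasing n L len adm) ,
  λ y x (1≤x , x<y , y≤n) → inv-build n L len adm y x
    (labelled∈L (≤-trans 1≤x (<⇒≤ x<y) , y≤n)) (labelled∈L (1≤x , ≤-trans (<⇒≤ x<y) y≤n)) x<y
  where
  open Realisation s n J JI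
  L : List ℕ
  L = applyDownFrom suc n

  L↭ : L ↭ map suc (upTo n)
  L↭ = ↭-trans (↭-reflexive (trans (sym (map-downFrom suc n)) (cong (map suc) (sym (reverse-upTo n)))))
               (map⁺ suc (↭-reverse (upTo n)))

  labelled∈L : ∀ {x} → Labelled n x → x ∈ L
  labelled∈L {suc x} (_ , x<n) = ∈-resp-↭ (↭-sym L↭) (∈-map⁺ suc (∈-upTo⁺ x<n))

  len : length L ≤ n
  len = ≤-reflexive (length-applyDownFrom suc n)

  adm : Admissible L
  adm = AllPairs.applyDownFrom⁺₁ suc n (λ j<i _ → s≤s j<i) ,
        All.tabulate λ x∈ → case ∈-map⁻ suc (∈-resp-↭ L↭ x∈) of λ { (y , y∈ , refl) → s≤s z≤n , ∈-upTo⁻ y∈ }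

record AscentInversions (s : ℕ → ℕ) (n : ℕ) (I : Multiset) (a b : ℕ) : Set where
  field
    not-last : I b a < s b
    above : ∀ z → b < z → z ≤ n → I z a ≡ I z b
    last-of-a : ∀ x → 1 ≤ x → x < a → I a x ≡ s a → 0 < s a → I b a < I b x
    between : ∀ y → a < y → y < b → (I y a ≡ s y) ⊎ (I b a < I b y)

-- The labels of T^a ∖ 0, read off the inversions once the last child of a is a leaf.
Carried : (ℕ → ℕ) → Multiset → ℕ → ℕ → Set
Carried s I a x = (x ≡ a) ⊎ ((x < a) × (0 < I a x) × (I a x < s a))

WeaklyRight : List ℕ → List ℕ → Set
WeaklyRight r q = ∀ r₁ h t k q' → r ≡ r₁ ++ h ∷ t → q ≡ r₁ ++ k ∷ q' → k ≤ h

WeaklyRight-∷ : ∀ {h r q} → WeaklyRight (h ∷ r) (h ∷ q) → WeaklyRight r q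
WeaklyRight-∷ wr r₁ h t k q' e₁ e₂ = wr (_ ∷ r₁) h t k q' (cong (_ ∷_) e₁) (cong (_ ∷_) e₂)

WeaklyRightBelow : List ℕ → ℕ → List ℕ → List ℕ → Set
WeaklyRightBelow pb i r px = ∀ q → px ≡ pb ++ i ∷ q → WeaklyRight r q

WeaklyRightBelow-∷ : ∀ {h pb i r q} → WeaklyRightBelow (h ∷ pb) i r (h ∷ q) → WeaklyRightBelow pb i r q
WeaklyRightBelow-∷ wr q e = wr q (cong (_ ∷_) e)

WeaklyRight⇒cmpPath≢ : ∀ sa r q → WeaklyRight r q → (∀ q' → q ≢ r ++ sa ∷ q') → 0 < sa → cmpPath sa r q ≢ sa
WeaklyRight⇒cmpPath≢ sa [] [] wr ¬last pos e = <⇒≢ pos e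
WeaklyRight⇒cmpPath≢ sa [] (k ∷ q) wr ¬last pos refl = ¬last q refl
WeaklyRight⇒cmpPath≢ sa (h ∷ r) [] wr ¬last pos e = <⇒≢ pos e
WeaklyRight⇒cmpPath≢ sa (h ∷ r) (k ∷ q) wr ¬last pos e with <-cmp h k
... | tri< h<k _ _ = <⇒≱ h<k (wr [] h r k q refl refl)
... | tri≈ _ refl _ rewrite cmpPath-∷ sa h r q =
  WeaklyRight⇒cmpPath≢ sa r q (WeaklyRight-∷ wr) (λ q' z → ¬last q' (cong (h ∷_) z)) pos e
... | tri> _ _ k<h rewrite cmpPath-left sa h k r q k<h = <⇒≢ pos e

WeaklyRight⇒cmpPath≡ : ∀ sy r q → WeaklyRight r q → (∀ j q' → r ≡ q ++ j ∷ q' → j ≡ sy) → ¬ Prefix r q →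
  cmpPath sy q r ≡ sy
WeaklyRight⇒cmpPath≡ sy [] q wr last np = ⊥-elim (np (q , refl))
WeaklyRight⇒cmpPath≡ sy (h ∷ r) [] wr last np = last h r refl
WeaklyRight⇒cmpPath≡ sy (h ∷ r) (k ∷ q) wr last np with <-cmp k h
... | tri< k<h _ _ = cmpPath-right sy k h q r k<h
... | tri≈ _ refl _ rewrite cmpPath-∷ sy k q r =
  WeaklyRight⇒cmpPath≡ sy r q (WeaklyRight-∷ wr) (λ j q' z → last j q' (cong (k ∷_) z)) (¬Prefix-∷ np)
... | tri> _ _ h<k = ⊥-elim (<⇒≱ h<k (wr [] h r k q refl refl))

-- In the next two lemmas pb ++ i ∷ r is the path of a, which lies in child i of b (path pb).
cmpPath-last-of-a : ∀ sa sb i pb r px → i < sb → WeaklyRightBelow pb i r px →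
  (∀ q → px ≢ (pb ++ i ∷ r) ++ sa ∷ q) →
  cmpPath sa (pb ++ i ∷ r) px ≡ sa → 0 < sa → i < cmpPath sb pb px
cmpPath-last-of-a sa sb i [] r [] i<sb wr ¬last e pos = ⊥-elim (<⇒≢ pos e)
cmpPath-last-of-a sa sb i [] r (k ∷ q) i<sb wr ¬last e pos with <-cmp i k
... | tri< i<k _ _ = i<k
... | tri≈ _ refl _ rewrite cmpPath-∷ sa i r q =
  ⊥-elim (WeaklyRight⇒cmpPath≢ sa r q (wr q refl) (λ q' z → ¬last q' (cong (i ∷_) z)) pos e)
... | tri> _ _ k<i rewrite cmpPath-left sa i k r q k<i = ⊥-elim (<⇒≢ pos e)
cmpPath-last-of-a sa sb i (h ∷ pb) r [] i<sb wr ¬last e pos = ⊥-elim (<⇒≢ pos e)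
cmpPath-last-of-a sa sb i (h ∷ pb) r (k ∷ q) i<sb wr ¬last e pos with <-cmp h k
... | tri< h<k _ _ rewrite cmpPath-right sb h k pb q h<k = i<sb
... | tri≈ _ refl _ rewrite cmpPath-∷ sa h (pb ++ i ∷ r) q | cmpPath-∷ sb h pb q =
  cmpPath-last-of-a sa sb i pb r q i<sb (WeaklyRightBelow-∷ wr) (λ q' z → ¬last q' (cong (h ∷_) z)) e pos
... | tri> _ _ k<h rewrite cmpPath-left sa h k (pb ++ i ∷ r) q k<h = ⊥-elim (<⇒≢ pos e)

cmpPath-between : ∀ sy sb i pb r py → i < sb → WeaklyRightBelow pb i r py →
  (∀ j q → pb ++ i ∷ r ≡ py ++ j ∷ q → j ≡ sy) → ¬ Prefix py pb → ¬ Prefix (pb ++ i ∷ r) py →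
  (cmpPath sy py (pb ++ i ∷ r) ≡ sy) ⊎ (i < cmpPath sb pb py)
cmpPath-between sy sb i [] r [] i<sb wr last np₁ np₂ = ⊥-elim (np₁ ([] , refl))
cmpPath-between sy sb i [] r (k ∷ q) i<sb wr last np₁ np₂ with <-cmp k i
... | tri< k<i _ _ = inj₁ (cmpPath-right sy k i q r k<i)
... | tri≈ _ refl _ rewrite cmpPath-∷ sy k q r =
  inj₁ (WeaklyRight⇒cmpPath≡ sy r q (wr q refl) (λ j q' z → last j q' (cong (k ∷_) z)) (¬Prefix-∷ np₂))
... | tri> _ _ i<k = inj₂ i<k
cmpPath-between sy sb i (h ∷ pb) r [] i<sb wr last np₁ np₂ = ⊥-elim (np₁ (h ∷ pb , refl))
cmpPath-between sy sb i (h ∷ pb) r (k ∷ q) i<sb wr last np₁ np₂ with <-cmp h k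
... | tri< h<k _ _ rewrite cmpPath-right sb h k pb q h<k = inj₂ i<sb
... | tri≈ _ refl _ rewrite cmpPath-∷ sy h q (pb ++ i ∷ r) | cmpPath-∷ sb h pb q =
  cmpPath-between sy sb i pb r q i<sb (WeaklyRightBelow-∷ wr) (λ j q' z → last j q' (cong (h ∷_) z))
    (¬Prefix-∷ np₁) (¬Prefix-∷ np₂)
... | tri> _ _ k<h = inj₁ (cmpPath-right sy k h q (pb ++ i ∷ r) k<h)

last-child-empty : ∀ (s : ℕ → ℕ) T a pa x q → 0 < s a →
  (0 < s a → ∀ cs → subtree T a ≡ just (node a cs) → nth (s a) cs ≡ just leaf) →
  pathTo T a ≡ just pa → pathTo T x ≢ just (pa ++ s a ∷ q)
last-child-empty s T a pa x q pos leafLast ea ex with pathTo⇒at T a pa ea | pathTo⇒at T x (pa ++ s a ∷ q) ex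
... | csa , aa | csx , ax with leafLast pos csa (trans (subtree≡at T a pa ea) aa)
... | isLeaf rewrite at-++ T pa (s a ∷ q) (node a csa) aa | nth⇒atChild (s a) csa leaf q isLeaf with q | ax
... | [] | ()
... | _ ∷ _ | ()

module TreeAscent (s : ℕ → ℕ) (n : ℕ) (T : Tree) (sd : IsSDecTree s n T) (a b : ℕ)
  (1≤a : 1 ≤ a) (b≤n : b ≤ n) (asc : IsTreeAscent s T a b) where

  private
    dec : Decreasing s T
    dec = proj₂ sd
    a<b : a < b
    a<b = proj₁ asc
    i : ℕ
    i = proj₁ (proj₁ (proj₂ asc))
    i<sb : i < s b
    i<sb = proj₁ (proj₂ (proj₁ (proj₂ asc)))
    a∈Tbi : InChild T b i a
    a∈Tbi = proj₂ (proj₂ (proj₁ (proj₂ asc)))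
    a-rightmost : ∀ e j → a < e → e < b → InChild T e j a → j ≡ s e
    a-rightmost = proj₁ (proj₂ (proj₂ asc))
    lastLeaf : 0 < s a → ∀ cs → subtree T a ≡ just (node a cs) → nth (s a) cs ≡ just leaf
    lastLeaf = proj₂ (proj₂ (proj₂ asc))

    paths : ∃ λ pe → ∃ λ r → (pathTo T b ≡ just pe) × (pathTo T a ≡ just (pe ++ i ∷ r))
    paths = childIdx⇒pathTo T b a i a∈Tbi
    pb : List ℕ
    pb = proj₁ paths
    r : List ℕ
    r = proj₁ (proj₂ paths)
    eb : pathTo T b ≡ just pb
    eb = proj₁ (proj₂ (proj₂ paths))
    pa : List ℕ
    pa = pb ++ i ∷ r
    ea : pathTo T a ≡ just pa
    ea = proj₂ (proj₂ (proj₂ paths))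

    I : Multiset
    I = inv s T

    Iba : I b a ≡ i
    Iba = inv-childIdx s T b a i a∈Tbi

    labelled : ∀ {x} → 1 ≤ x → x ≤ b → Labelled n x
    labelled 1≤x x≤b = 1≤x , ≤-trans x≤b b≤n

    split-pa : ∀ r₁ h t → r ≡ r₁ ++ h ∷ t → pa ≡ (pb ++ i ∷ r₁) ++ h ∷ t
    split-pa r₁ h t e = trans (cong (λ z → pb ++ i ∷ z) e) (sym (++-assoc pb (i ∷ r₁) (h ∷ t)))

    -- condition (ii) of a tree ascent, at the vertices met on the way from b down to a
    on-the-way : ∀ r₁ h t → r ≡ r₁ ++ h ∷ t →
      ∃ λ e → ∃ λ cse → (at T (pb ++ i ∷ r₁) ≡ just (node e cse)) × (h ≡ s e)
    on-the-way r₁ h t split with pathTo⇒at T a pa ea | pathTo⇒at T b pb eb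
    ... | csa , aa | csb , bb with subst (λ z → at T z ≡ just (node a csa)) (split-pa r₁ h t split) aa
    ... | aa' with at-prefix T (pb ++ i ∷ r₁) h t _ aa'
    ... | e , cse , ae =
      let a<e = proj₁ (Decreasing-descendant s T (pb ++ i ∷ r₁) e cse h t a csa dec ae aa')
          e<b = proj₁ (Decreasing-descendant s T pb b csb i r₁ e cse dec bb ae)
          pe = at⇒pathTo s n T (pb ++ i ∷ r₁) e cse sd ae
          ea' = subst (λ z → pathTo T a ≡ just z) (split-pa r₁ h t split) ea
      in e , cse , ae , a-rightmost e h a<e e<b (pathTo⇒childIdx T e a (pb ++ i ∷ r₁) h t pe ea')

    weaklyRight : ∀ x px → pathTo T x ≡ just px → WeaklyRightBelow pb i r px
    weaklyRight x px ex q refl r₁ h t k q' split refl with on-the-way r₁ h t split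
    ... | e , cse , ae , refl with pathTo⇒at T x px ex
    ... | csx , ax = proj₂ (Decreasing-descendant s T (pb ++ i ∷ r₁) e cse k q' x csx dec ae
      (subst (λ z → at T z ≡ just (node x csx)) (sym (++-assoc pb (i ∷ r₁) (k ∷ q'))) ax))

  ascent-inversions : AscentInversions s n I a b
  ascent-inversions = record
    { not-last = subst (_< s b) (sym Iba) i<sb
    ; above = above
    ; last-of-a = last-of-a
    ; between = between
    }
    where
    above : ∀ z → b < z → z ≤ n → I z a ≡ I z b
    above z b<z z≤n' with labelled⇒pathTo s n T z sd (≤-trans 1≤a (<⇒≤ (<-trans a<b b<z)) , z≤n')
    ... | pz , ez rewrite inv-pathTo s T z a pz pa ez ea | inv-pathTo s T z b pz pb ez eb =
      cmpPath-++ʳ (s z) pz pb (i ∷ r) (smaller⇒¬ancestor s T b z pb pz dec eb ez b<z)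

    last-of-a : ∀ x → 1 ≤ x → x < a → I a x ≡ s a → 0 < s a → I b a < I b x
    last-of-a x 1≤x x<a e pos with labelled⇒pathTo s n T x sd (labelled 1≤x (<⇒≤ (<-trans x<a a<b)))
    ... | px , ex rewrite Iba | inv-pathTo s T b x pb px eb ex | inv-pathTo s T a x pa px ea ex =
      cmpPath-last-of-a (s a) (s b) i pb r px i<sb (weaklyRight x px ex)
        (λ q e' → last-child-empty s T a pa x q pos lastLeaf ea (trans ex (cong just e'))) e pos

    between : ∀ y → a < y → y < b → (I y a ≡ s y) ⊎ (I b a < I b y)
    between y a<y y<b with labelled⇒pathTo s n T y sd (labelled (≤-trans 1≤a (<⇒≤ a<y)) (<⇒≤ y<b))
    ... | py , ey rewrite Iba | inv-pathTo s T b y pb py eb ey | inv-pathTo s T y a py pa ey ea =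
      cmpPath-between (s y) (s b) i pb r py i<sb (weaklyRight y py ey)
        (λ j q e' → a-rightmost y j a<y y<b (pathTo⇒childIdx T y a py j q ey (trans ea (cong just e'))))
        (smaller⇒¬ancestor s T y b py pb dec ey eb y<b) (smaller⇒¬ancestor s T a y pa py dec ea ey a<y)

  childIdx-ascent : childIdx T b a ≡ just (I b a)
  childIdx-ascent = trans a∈Tbi (cong just (sym Iba))

  inSubNot0⇒Carried : ∀ x → inSubNot0 T a x ≡ true → Carried s I a x
  inSubNot0⇒Carried x h with x ≟ a
  ... | yes x≡a = inj₁ x≡a
  ... | no x≢a rewrite dec-false (x ≟ a) x≢a with childIdx T a x in ci
  ... | just (suc j) with childIdx⇒pathTo T a x (suc j) ci
  ... | pa' , r' , ea' , ex with trans (sym ea') ea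
  ... | refl with pathTo⇒at T a pa ea | pathTo⇒at T x (pa ++ suc j ∷ r') ex
  ... | csa , aa | csx , ax with Decreasing-descendant s T pa a csa (suc j) r' x csx dec aa ax
  ... | x<a , 1+j≤sa rewrite inv-childIdx s T a x (suc j) ci =
    inj₂ (x<a , s≤s z≤n , ≤∧≢⇒< 1+j≤sa λ e →
      last-child-empty s T a pa x r' (subst (0 <_) e (s≤s z≤n)) lastLeaf ea (subst (λ k → pathTo T x ≡ just (pa ++ k ∷ r')) e ex))
  inSubNot0⇒Carried x () | no x≢a | just zero
  inSubNot0⇒Carried x () | no x≢a | nothing

  Carried⇒inSubNot0 : ∀ x → 1 ≤ x → Carried s I a x → inSubNot0 T a x ≡ true
  Carried⇒inSubNot0 x 1≤x (inj₁ refl) rewrite dec-true (x ≟ x) refl = refl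
  Carried⇒inSubNot0 x 1≤x (inj₂ (x<a , pos , <sa)) rewrite dec-false (x ≟ a) (<⇒≢ x<a)
    with labelled⇒pathTo s n T x sd (labelled 1≤x (<⇒≤ (<-trans x<a a<b)))
  ... | px , ex with cmpPath-inner (s a) pa px (I a x) (sym (inv-pathTo s T a x pa px ea ex))
                       (≢-sym (<⇒≢ pos)) (<⇒≢ <sa)
  ... | r' , e rewrite pathTo⇒childIdx T a x pa (I a x) r' ea (trans ex (cong just e)) with I a x | pos
  ... | suc _ | _ = refl

raise : Multiset → ℕ → {P : ℕ → Set} → Decidable P → Multiset
raise I b P? y x = if does (y ≟ b) ∧ does (P? x) then suc (I y x) else I y x

module _ (I : Multiset) (b : ℕ) {P : ℕ → Set} (P? : Decidable P) where

  raise-hit : ∀ {x} → P x → raise I b P? b x ≡ suc (I b x)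
  raise-hit {x} px rewrite dec-true (b ≟ b) refl | dec-true (P? x) px = refl

  raise-miss : ∀ {y x} → ¬ P x → raise I b P? y x ≡ I y x
  raise-miss {y} {x} ¬px rewrite dec-false (P? x) ¬px with does (y ≟ b)
  ... | true = refl
  ... | false = refl

  raise-other : ∀ {y x} → y ≢ b → raise I b P? y x ≡ I y x
  raise-other {y} y≢b rewrite dec-false (y ≟ b) y≢b = refl

  raise-≥ : ∀ y x → I y x ≤ raise I b P? y x
  raise-≥ y x with does (y ≟ b) ∧ does (P? x)
  ... | true = n≤1+n _
  ... | false = ≤-refl

  raise-≤ : ∀ y x → raise I b P? y x ≤ suc (I y x)
  raise-≤ y x with does (y ≟ b) ∧ does (P? x)
  ... | true = ≤-refl
  ... | false = n≤1+n _

  raise-increased : ∀ y x → I y x < raise I b P? y x → (y ≡ b) × P x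
  raise-row : ∀ x → (P x × raise I b P? b x ≡ suc (I b x)) ⊎ (¬ P x × raise I b P? b x ≡ I b x)
  raise-row x = case P? x of λ
    { (yes px) → inj₁ (px , raise-hit px)
    ; (no ¬px) → inj₂ (¬px , raise-miss ¬px) }

  raise-increased y x lt =
    decidable-stable (y ≟ b) (λ y≢b → <-irrefl refl (subst (I y x <_) (raise-other y≢b) lt)) ,
    decidable-stable (P? x) (λ ¬px → <-irrefl refl (subst (I y x <_) (raise-miss ¬px) lt))

-- Conditions under which raising row b on P preserves the inversion axioms.
record Raisable (s : ℕ → ℕ) (n : ℕ) (I : Multiset) (b : ℕ) (P : ℕ → Set) : Set where
  field
    room : ∀ x → 1 ≤ x → x < b → P x → I b x < s b
    separated : ∀ x y → 1 ≤ x → x < y → y < b → P y → ¬ P x → 0 < I y x → I b y < I b x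
    above-zero : ∀ x z → 1 ≤ x → x < b → b < z → z ≤ n → P x → I b x ≡ 0 → I z b ≤ I z x
    split : ∀ x y → 1 ≤ x → x < y → y < b → P x → ¬ P y → (I y x ≡ s y) ⊎ (I b x < I b y)

Raisable-∪ : ∀ {s n I b P Q} → Raisable s n I b P → Raisable s n I b Q → Raisable s n I b (λ x → P x ⊎ Q x)
Raisable-∪ RP RQ = record
  { room = λ x 1≤x x<b → [ RP.room x 1≤x x<b , RQ.room x 1≤x x<b ]
  ; separated = λ x y 1≤x x<y y<b py∪qy ¬px∪qx →
      [ (λ py → RP.separated x y 1≤x x<y y<b py (¬px∪qx ∘ inj₁))
      , (λ qy → RQ.separated x y 1≤x x<y y<b qy (¬px∪qx ∘ inj₂)) ] py∪qy
  ; above-zero = λ x z 1≤x x<b b<z z≤n' → [ RP.above-zero x z 1≤x x<b b<z z≤n' , RQ.above-zero x z 1≤x x<b b<z z≤n' ]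
  ; split = λ x y 1≤x x<y y<b px∪qx ¬py∪qy →
      [ (λ px → RP.split x y 1≤x x<y y<b px (¬py∪qy ∘ inj₁))
      , (λ qx → RQ.split x y 1≤x x<y y<b qx (¬py∪qy ∘ inj₂)) ] px∪qx
  }
  where
  module RP = Raisable RP
  module RQ = Raisable RQ

module _ {s n I b P} (P? : Decidable P) (II : IsTreeInversions s n I) (R : Raisable s n I b P) where

  open IsTreeInversions II
  open Raisable R
  private
    J : Multiset
    J = raise I b P?

  raise-transitive : Transitive n J
  raise-transitive x y z 1≤x x<y y<z z≤n' with z ≟ b
  ... | yes refl rewrite raise-other I b P? {y} {x} (<⇒≢ y<z) with I y x in Iyx
  ...   | zero = inj₁ refl
  ...   | suc _ with transitive x y b 1≤x x<y y<z z≤n'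
  ...     | inj₁ e = ⊥-elim (0≢1+n (trans (sym e) Iyx))
  ...     | inj₂ le with raise-row I b P? y | raise-row I b P? x
  ...       | inj₁ (py , ey) | inj₁ (px , ex) rewrite ey | ex = inj₂ (s≤s le)
  ...       | inj₁ (py , ey) | inj₂ (¬px , ex) rewrite ey | ex =
    inj₂ (separated x y 1≤x x<y y<z py ¬px (subst (0 <_) (sym Iyx) (s≤s z≤n)))
  ...       | inj₂ (¬py , ey) | _ rewrite ey = inj₂ (≤-trans le (raise-≥ I b P? b x))
  raise-transitive x y z 1≤x x<y y<z z≤n' | no z≢b
    rewrite raise-other I b P? {z} {y} z≢b | raise-other I b P? {z} {x} z≢b with y ≟ b
  ... | no y≢b rewrite raise-other I b P? {y} {x} y≢b = transitive x y z 1≤x x<y y<z z≤n'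
  ... | yes refl with I y x in Ibx | raise-row I b P? x
  ...   | zero | inj₁ (px , _) = inj₂ (above-zero x z 1≤x x<y y<z z≤n' px Ibx)
  ...   | zero | inj₂ (_ , ex) rewrite ex = inj₁ refl
  ...   | suc _ | _ with transitive x y z 1≤x x<y y<z z≤n'
  ...     | inj₁ e = ⊥-elim (0≢1+n (trans (sym e) Ibx))
  ...     | inj₂ le = inj₂ le

  raise-planar : Planar s n J
  raise-planar x y z 1≤x x<y y<z z≤n' pos with z ≟ b
  raise-planar x y z 1≤x x<y y<z z≤n' pos | no z≢b
    rewrite raise-other I b P? {z} {y} z≢b | raise-other I b P? {z} {x} z≢b
    with planar x y z 1≤x x<y y<z z≤n' pos
  ... | inj₂ le = inj₂ le
  ... | inj₁ e with y ≟ b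
  ...   | no y≢b rewrite raise-other I b P? {y} {x} y≢b = inj₁ e
  ...   | yes refl with raise-row I b P? x
  ...     | inj₁ (px , _) = ⊥-elim (<⇒≢ (room x 1≤x x<y px) e)
  ...     | inj₂ (_ , ex) rewrite ex = inj₁ e
  raise-planar x y z 1≤x x<y y<z z≤n' pos | yes refl
    rewrite raise-other I b P? {y} {x} (<⇒≢ y<z) with raise-row I b P? x
  ... | inj₂ (_ , ex) rewrite ex with planar x y b 1≤x x<y y<z z≤n' pos
  ...   | inj₁ e = inj₁ e
  ...   | inj₂ le = inj₂ (≤-trans le (raise-≥ I b P? b y))
  raise-planar x y z 1≤x x<y y<z z≤n' pos | yes refl | inj₁ (px , ex) rewrite ex with raise-row I b P? y
  ... | inj₂ (¬py , ey) rewrite ey = split x y 1≤x x<y y<z px ¬py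
  ... | inj₁ (py , ey) rewrite ey with I b x in Ibx
  ...   | zero = inj₂ (s≤s z≤n)
  ...   | suc _ with planar x y b 1≤x x<y y<z z≤n' (subst (0 <_) (sym Ibx) (s≤s z≤n))
  ...     | inj₁ e = inj₁ e
  ...     | inj₂ le = inj₂ (s≤s (subst (_≤ I b y) Ibx le))

  raise-bounded : Bounded s n J
  raise-bounded y x pair@(1≤x , x<y , _) with y ≟ b
  ... | no y≢b rewrite raise-other I b P? {y} {x} y≢b = bounded y x pair
  ... | yes refl with raise-row I b P? x
  ...   | inj₁ (px , ex) rewrite ex = room x 1≤x x<y px
  ...   | inj₂ (_ , ex) rewrite ex = bounded b x pair

  raise-IsTreeInversions : IsTreeInversions s n J
  raise-IsTreeInversions = record
    { transitive = raise-transitive ; planar = raise-planar ; bounded = raise-bounded }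

module _ (s : ℕ → ℕ) (n : ℕ) (I : Multiset) (b a : ℕ) (room : I b a < s b) where

  plusPair-hit : plusPair s I b a b a ≡ suc (I b a)
  plusPair-hit rewrite dec-true (b ≟ b) refl | dec-true (a ≟ a) refl = m≤n⇒m⊓n≡m room

  plusPair-other : ∀ y x → ¬ ((y ≡ b) × (x ≡ a)) → plusPair s I b a y x ≡ I y x
  plusPair-other y x ¬ba with y ≟ b
  ... | no y≢b rewrite dec-false (y ≟ b) y≢b = refl
  ... | yes refl rewrite dec-true (y ≟ y) refl | dec-false (x ≟ a) (λ x≡a → ¬ba (refl , x≡a)) = refl

  plusPair-≥ : ∀ y x → I y x ≤ plusPair s I b a y x
  plusPair-≥ y x with y ≟ b | x ≟ a
  ... | yes refl | yes refl = ≤-trans (n≤1+n _) (≤-reflexive (sym plusPair-hit))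
  ... | yes refl | no x≢a = ≤-reflexive (sym (plusPair-other y x (x≢a ∘ proj₂)))
  ... | no y≢b | _ = ≤-reflexive (sym (plusPair-other y x (y≢b ∘ proj₁)))

  plusPair-⊑-hit : ∀ Z → Pair n b a → plusPair s I b a ⊑[ n ] Z → suc (I b a) ≤ Z b a
  plusPair-⊑-hit Z p le = subst (_≤ Z b a) plusPair-hit (le b a p)

  ⊑-plusPair : ∀ K → I ⊑[ n ] K → suc (I b a) ≤ K b a → plusPair s I b a ⊑[ n ] K
  ⊑-plusPair K I⊑K hit y x p with y ≟ b | x ≟ a
  ... | yes refl | yes refl = subst (_≤ K y x) (sym plusPair-hit) hit
  ... | yes refl | no x≢a = subst (_≤ K y x) (sym (plusPair-other y x (x≢a ∘ proj₂))) (I⊑K y x p)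
  ... | no y≢b | _ = subst (_≤ K y x) (sym (plusPair-other y x (y≢b ∘ proj₁))) (I⊑K y x p)

  plusPair-⊑⇒⊑ : ∀ Z → plusPair s I b a ⊑[ n ] Z → I ⊑[ n ] Z
  plusPair-⊑⇒⊑ Z le y x p = ≤-trans (plusPair-≥ y x) (le y x p)

carried? : ∀ s I a → Decidable (Carried s I a)
carried? s I a x = (x ≟ a) ⊎-dec ((x <? a) ×-dec ((0 <? I a x) ×-dec (I a x <? s a)))

module OneAscent (s : ℕ → ℕ) (n : ℕ) (I : Multiset) (II : IsTreeInversions s n I)
  (a b : ℕ) (1≤a : 1 ≤ a) (a<b : a < b) (b≤n : b ≤ n) (AI : AscentInversions s n I a b) where

  open IsTreeInversions II
  open AscentInversions AI

  a≤n : a ≤ n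
  a≤n = ≤-trans (<⇒≤ a<b) b≤n

  Carried⇒≤ : ∀ {x} → Carried s I a x → x ≤ a
  Carried⇒≤ (inj₁ refl) = ≤-refl
  Carried⇒≤ (inj₂ (x<a , _)) = <⇒≤ x<a

  Carried-above : ∀ {x} → 1 ≤ x → Carried s I a x → ∀ z → a < z → z ≤ n → I z x ≡ I z a
  Carried-above 1≤x (inj₁ refl) z _ _ = refl
  Carried-above {x} 1≤x (inj₂ (x<a , pos , <sa)) z a<z z≤n' = ≤-antisym up down
    where
    down : I z a ≤ I z x
    down with transitive x a z 1≤x x<a a<z z≤n'
    ... | inj₁ e = ⊥-elim (<⇒≢ pos (sym e))
    ... | inj₂ le = le
    up : I z x ≤ I z a
    up with I z x in Izx
    ... | zero = z≤n
    ... | suc _ with planar x a z 1≤x x<a a<z z≤n' (subst (0 <_) (sym Izx) (s≤s z≤n))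
    ...   | inj₁ e = ⊥-elim (<⇒≢ <sa e)
    ...   | inj₂ le = subst (_≤ I z a) Izx le

  ¬Carried : ∀ {x} → 1 ≤ x → x < a → ¬ Carried s I a x → (I a x ≡ 0) ⊎ (I a x ≡ s a)
  ¬Carried {x} 1≤x x<a ¬c with I a x in Iax
  ... | zero = inj₁ refl
  ... | suc k with suc k <? s a
  ...   | yes <sa = ⊥-elim (¬c (inj₂ (x<a , s≤s z≤n , <sa)))
  ...   | no ≮sa = inj₂ (≤-antisym (subst (_≤ s a) Iax (bounded a x (1≤x , x<a , a≤n))) (≮⇒≥ ≮sa))

  Carried-row-b : ∀ {x} → 1 ≤ x → Carried s I a x → I b x ≡ I b a
  Carried-row-b 1≤x c = Carried-above 1≤x c b a<b b≤n

  Carried-Raisable : Raisable s n I b (Carried s I a)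
  Carried-Raisable = record { room = room ; separated = separated ; above-zero = above-zero ; split = split }
    where
    room : ∀ x → 1 ≤ x → x < b → Carried s I a x → I b x < s b
    room x 1≤x _ c rewrite Carried-row-b 1≤x c = not-last

    separated : ∀ x y → 1 ≤ x → x < y → y < b → Carried s I a y → ¬ Carried s I a x → 0 < I y x → I b y < I b x
    separated x y 1≤x x<y y<b cy ¬cx pos rewrite Carried-row-b (≤-trans 1≤x (<⇒≤ x<y)) cy with cy
    ... | inj₁ refl with ¬Carried 1≤x x<y ¬cx
    ...   | inj₁ e = ⊥-elim (<⇒≢ pos (sym e))
    ...   | inj₂ e = last-of-a x 1≤x x<y e (subst (0 <_) e pos)
    separated x y 1≤x x<y y<b cy ¬cx pos | inj₂ (y<a , posy , _) with transitive x y a 1≤x x<y y<a a≤n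
    ... | inj₁ e = ⊥-elim (<⇒≢ pos (sym e))
    ... | inj₂ le with ¬Carried 1≤x (<-trans x<y y<a) ¬cx
    ...   | inj₁ e = ⊥-elim (<⇒≢ (<-≤-trans posy le) (sym e))
    ...   | inj₂ e = last-of-a x 1≤x (<-trans x<y y<a) e (<-≤-trans posy (≤-trans le (≤-reflexive e)))

    above-zero : ∀ x z → 1 ≤ x → x < b → b < z → z ≤ n → Carried s I a x → I b x ≡ 0 → I z b ≤ I z x
    above-zero x z 1≤x _ b<z z≤n' c _
      rewrite Carried-above 1≤x c z (<-trans a<b b<z) z≤n' | above z b<z z≤n' = ≤-refl

    split : ∀ x y → 1 ≤ x → x < y → y < b → Carried s I a x → ¬ Carried s I a y → (I y x ≡ s y) ⊎ (I b x < I b y)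
    split x y 1≤x x<y y<b cx ¬cy rewrite Carried-row-b 1≤x cx with <-cmp y a
    ... | tri≈ _ refl _ = ⊥-elim (¬cy (inj₁ refl))
    ... | tri> _ _ a<y with between y a<y y<b
    ...   | inj₂ lt = inj₂ lt
    ...   | inj₁ e with cx
    ...     | inj₁ refl = inj₁ e
    ...     | inj₂ (x<a , posx , _) with transitive x a y 1≤x x<a a<y (≤-trans (<⇒≤ y<b) b≤n)
    ...       | inj₁ e' = ⊥-elim (<⇒≢ posx (sym e'))
    ...       | inj₂ le = inj₁ (≤-antisym (bounded y x (1≤x , x<y , ≤-trans (<⇒≤ y<b) b≤n)) (subst (_≤ I y x) e le))
    split x y 1≤x x<y y<b cx ¬cy | tri< y<a _ _ with cx
    ... | inj₁ refl = ⊥-elim (<-asym x<y y<a)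
    ... | inj₂ (_ , posx , <sa) with ¬Carried (≤-trans 1≤x (<⇒≤ x<y)) y<a ¬cy
    ...   | inj₂ e = inj₂ (last-of-a y (≤-trans 1≤x (<⇒≤ x<y)) y<a e (<-trans posx <sa))
    ...   | inj₁ e with planar x y a 1≤x x<y y<a a≤n posx
    ...     | inj₁ e' = inj₁ e'
    ...     | inj₂ le = ⊥-elim (<⇒≢ (<-≤-trans posx (≤-trans le (≤-reflexive e))) refl)

  rotation-raises : ∀ Z → Transitive n Z → plusPair s I b a ⊑[ n ] Z →
    ∀ x → 1 ≤ x → Carried s I a x → I b x < Z b x
  rotation-raises Z Ztr I⁺⊑Z x 1≤x cx rewrite Carried-row-b 1≤x cx with cx
  ... | inj₁ refl = plusPair-⊑-hit s n I b a not-last Z (1≤a , a<b , b≤n) I⁺⊑Z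
  ... | inj₂ (x<a , pos , _) with Ztr x a b 1≤x x<a a<b b≤n
  ...   | inj₁ e = ⊥-elim (<⇒≢ (<-≤-trans pos (plusPair-⊑⇒⊑ s n I b a not-last Z I⁺⊑Z a x (1≤x , x<a , a≤n))) (sym e))
  ...   | inj₂ l = ≤-trans (plusPair-⊑-hit s n I b a not-last Z (1≤a , a<b , b≤n) I⁺⊑Z) l

module TwoAscents (s : ℕ → ℕ) (n : ℕ) (I : Multiset) (II : IsTreeInversions s n I)
  (a b c d : ℕ) (1≤a : 1 ≤ a) (a<b : a < b) (b≤n : b ≤ n) (1≤c : 1 ≤ c) (c<d : c < d) (d≤n : d ≤ n)
  (a<c : a < c) (AI : AscentInversions s n I a b) (CI : AscentInversions s n I c d) where

  open IsTreeInversions II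
  open ≡-Reasoning
  module A = OneAscent s n I II a b 1≤a a<b b≤n AI
  module C = OneAscent s n I II c d 1≤c c<d d≤n CI
  module AI = AscentInversions AI
  module CI = AscentInversions CI

  -- the case in which F_T(a,c) is non-empty
  FCase : Set
  FCase = (b ≡ c) × (I b a ≡ 0)

  CarriedA : ℕ → Set
  CarriedA = Carried s I a
  CarriedC : ℕ → Set
  CarriedC = Carried s I c

  -- pairs (d , x) raised by the join besides those of the rotation along (c , d)
  RaisedAtD : ℕ → Set
  RaisedAtD x = CarriedC x ⊎ (FCase × CarriedA x)

  raisedAtD? : Decidable RaisedAtD
  raisedAtD? x = carried? s I c x ⊎-dec (((b ≟ c) ×-dec (I b a ≟ 0)) ×-dec carried? s I a x)

  c≤n : c ≤ n
  c≤n = ≤-trans (<⇒≤ c<d) d≤n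

  FCase-above : FCase → ∀ z → c < z → z ≤ n → I z a ≡ I z c
  FCase-above (refl , _) z c<z z≤n' = AI.above z c<z z≤n'

  FCase-row-d : FCase → ∀ {x} → 1 ≤ x → CarriedA x → I d x ≡ I d c
  FCase-row-d F 1≤x cx = trans (A.Carried-above 1≤x cx d (<-trans a<c c<d) d≤n) (FCase-above F d c<d d≤n)

  K₁ : Multiset
  K₁ = raise I b (carried? s I a)

  K₁-IsTreeInversions : IsTreeInversions s n K₁
  K₁-IsTreeInversions = raise-IsTreeInversions (carried? s I a) II A.Carried-Raisable

  K₁-full : ∀ {x y} → 1 ≤ x → x < y → I y x ≡ s y → K₁ y x ≡ s y
  K₁-full {x} {y} 1≤x x<y e with y ≟ b
  ... | no y≢b = trans (raise-other I b (carried? s I a) y≢b) e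
  ... | yes refl with raise-row I y (carried? s I a) x
  ...   | inj₁ (cx , _) = ⊥-elim (<⇒≢ (Raisable.room A.Carried-Raisable x 1≤x x<y cx) e)
  ...   | inj₂ (_ , ex) = trans ex e

  module _ (b≢d : b ≢ d) where

    K₁-row-d : ∀ x → K₁ d x ≡ I d x
    K₁-row-d x = raise-other I b (carried? s I a) (≢-sym b≢d)

    private
      room : ∀ x → 1 ≤ x → x < d → RaisedAtD x → K₁ d x < s d
      room x 1≤x x<d (inj₁ cx) rewrite K₁-row-d x = Raisable.room C.Carried-Raisable x 1≤x x<d cx
      room x 1≤x x<d (inj₂ (F , cx)) rewrite K₁-row-d x | FCase-row-d F 1≤x cx = CI.not-last

      separated : ∀ x y → 1 ≤ x → x < y → y < d → RaisedAtD y → ¬ RaisedAtD x → 0 < K₁ y x → K₁ d y < K₁ d x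
      separated x y 1≤x x<y y<d ry ¬rx pos rewrite K₁-row-d x | K₁-row-d y with ry
      ... | inj₂ (F@(refl , Iba≡0) , cy) =
        subst (_< I d x) (sym (FCase-row-d F 1≤y cy)) (CI.last-of-a x 1≤x x<c Icx≡sc (subst (0 <_) Icx≡sc 0<Icx))
        where
        1≤y : 1 ≤ y
        1≤y = ≤-trans 1≤x (<⇒≤ x<y)
        ¬cx : ¬ CarriedA x
        ¬cx = λ cx → ¬rx (inj₂ (F , cx))
        x<c : x < c
        x<c = <-≤-trans x<y (≤-trans (A.Carried⇒≤ cy) (<⇒≤ a<c))
        0<Icx : 0 < I b x
        0<Icx = subst (_< I b x) (trans (A.Carried-row-b 1≤y cy) Iba≡0)
          (Raisable.separated A.Carried-Raisable x y 1≤x x<y (≤-<-trans (A.Carried⇒≤ cy) a<b) cy ¬cx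
            (subst (0 <_) (raise-miss I b (carried? s I a) ¬cx) pos))
        Icx≡sc : I b x ≡ s b
        Icx≡sc with C.¬Carried 1≤x x<c (λ cx → ¬rx (inj₁ cx))
        ... | inj₁ e = ⊥-elim (<⇒≢ 0<Icx (sym e))
        ... | inj₂ e = e
      ... | inj₁ cy with I y x ≟ 0
      ...   | no Iyx≢0 = Raisable.separated C.Carried-Raisable x y 1≤x x<y y<d cy (λ cx → ¬rx (inj₁ cx))
                           (n≢0⇒n>0 Iyx≢0)
      ...   | yes Iyx with raise-increased I b (carried? s I a) y x (subst (_< K₁ y x) (sym Iyx) pos)
      ...     | refl , cx with cy
      ...       | inj₁ refl = ⊥-elim (¬rx (inj₂ ((refl , trans (sym (A.Carried-row-b 1≤x cx)) Iyx) , cx)))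
      ...       | inj₂ (y<c , 0<Icy , Icy<sc) =
        ⊥-elim (¬rx (inj₁ (inj₂ (<-trans x<y y<c , subst (0 <_) (sym Icx≡Icy) 0<Icy , subst (_< s c) (sym Icx≡Icy) Icy<sc))))
        where
        Icx≡Icy : I c x ≡ I c y
        Icx≡Icy = trans (A.Carried-above 1≤x cx c a<c c≤n) (AI.above c y<c c≤n)

      above-zero : ∀ x z → 1 ≤ x → x < d → d < z → z ≤ n → RaisedAtD x → K₁ d x ≡ 0 → K₁ z d ≤ K₁ z x
      above-zero x z 1≤x x<d d<z z≤n' rx K₁dx≡0 =
        ≤-trans (≤-reflexive K₁zd≡Izd) (≤-trans (Izd≤Izx rx) (raise-≥ I b (carried? s I a) z x))
        where
        K₁zd≡Izd : K₁ z d ≡ I z d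
        K₁zd≡Izd = raise-miss I b (carried? s I a) λ cd → <⇒≱ (<-trans a<c c<d) (A.Carried⇒≤ cd)
        Izd≤Izx : RaisedAtD x → I z d ≤ I z x
        Izd≤Izx (inj₁ cx) = Raisable.above-zero C.Carried-Raisable x z 1≤x x<d d<z z≤n' cx
                              (trans (sym (K₁-row-d x)) K₁dx≡0)
        Izd≤Izx (inj₂ (F , cx)) = ≤-reflexive (sym (begin
          I z x ≡⟨ A.Carried-above 1≤x cx z (<-trans (<-trans a<c c<d) d<z) z≤n' ⟩
          I z a ≡⟨ FCase-above F z (<-trans c<d d<z) z≤n' ⟩
          I z c ≡⟨ CI.above z d<z z≤n' ⟩
          I z d ∎))

      split : ∀ x y → 1 ≤ x → x < y → y < d → RaisedAtD x → ¬ RaisedAtD y → (K₁ y x ≡ s y) ⊎ (K₁ d x < K₁ d y)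
      split x y 1≤x x<y y<d rx ¬ry rewrite K₁-row-d x | K₁-row-d y with rx
      ... | inj₁ cx = map₁ (K₁-full 1≤x x<y)
                        (Raisable.split C.Carried-Raisable x y 1≤x x<y y<d cx (λ cy → ¬ry (inj₁ cy)))
      ... | inj₂ (F@(refl , Iba≡0) , cx) rewrite FCase-row-d F 1≤x cx with <-cmp y b
      ...   | tri≈ _ refl _ = ⊥-elim (¬ry (inj₁ (inj₁ refl)))
      ...   | tri> _ _ c<y = map₁ (λ e → K₁-full 1≤x x<y (trans Iyx≡Iyc e)) (CI.between y c<y y<d)
        where
        y≤n : y ≤ n
        y≤n = ≤-trans (<⇒≤ y<d) d≤n
        Iyx≡Iyc : I y x ≡ I y b
        Iyx≡Iyc = trans (A.Carried-above 1≤x cx y (<-trans a<b c<y) y≤n) (FCase-above F y c<y y≤n)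
      ...   | tri< y<c _ _ with Raisable.split A.Carried-Raisable x y 1≤x x<y y<c cx (λ cy → ¬ry (inj₂ (F , cy)))
      ...     | inj₁ e = inj₁ (K₁-full 1≤x x<y e)
      ...     | inj₂ lt = inj₂ (CI.last-of-a y 1≤y y<c Icy≡sc (subst (0 <_) Icy≡sc 0<Icy))
        where
        1≤y : 1 ≤ y
        1≤y = ≤-trans 1≤x (<⇒≤ x<y)
        0<Icy : 0 < I b y
        0<Icy = subst (_< I b y) (trans (A.Carried-row-b 1≤x cx) Iba≡0) lt
        Icy≡sc : I b y ≡ s b
        Icy≡sc with C.¬Carried 1≤y y<c (λ cy → ¬ry (inj₁ cy))
        ... | inj₁ e = ⊥-elim (<⇒≢ 0<Icy (sym e))
        ... | inj₂ e = e

    RaisedAtD-Raisable : Raisable s n K₁ d RaisedAtD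
    RaisedAtD-Raisable = record { room = room ; separated = separated ; above-zero = above-zero ; split = split }

  Increment : ℕ → ℕ → Set
  Increment y x = ((y ≡ b) × CarriedA x) ⊎ ((y ≡ d) × CarriedC x) ⊎ (FCase × (y ≡ d) × CarriedA x)

  -- Such a K is realised by a tree above Z and Q, hence above Z ∨ Q.
  record UpperBound (K : Multiset) : Set where
    field
      inversions : IsTreeInversions s n K
      I⊑K : I ⊑[ n ] K
      raised-ba : suc (I b a) ≤ K b a
      raised-dc : suc (I d c) ≤ K d c
      by-at-most-one : ∀ y x → K y x ≤ suc (I y x)
      increments : ∀ y x → I y x < K y x → Increment y x

  upper-bound : ∃ UpperBound
  upper-bound with b ≟ d
  ... | yes refl = raise I b carried-a-or-c? , record
    { inversions = raise-IsTreeInversions carried-a-or-c? II (Raisable-∪ A.Carried-Raisable C.Carried-Raisable)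
    ; I⊑K = λ y x _ → raise-≥ I b carried-a-or-c? y x
    ; raised-ba = ≤-reflexive (sym (raise-hit I b carried-a-or-c? (inj₁ (inj₁ refl))))
    ; raised-dc = ≤-reflexive (sym (raise-hit I b carried-a-or-c? (inj₂ (inj₁ refl))))
    ; by-at-most-one = raise-≤ I b carried-a-or-c?
    ; increments = λ y x lt → case raise-increased I b carried-a-or-c? y x lt of λ
        { (y≡b , inj₁ cx) → inj₁ (y≡b , cx)
        ; (y≡b , inj₂ cx) → inj₂ (inj₁ (y≡b , cx)) }
    }
    where
    carried-a-or-c? : Decidable (λ x → CarriedA x ⊎ CarriedC x)
    carried-a-or-c? x = carried? s I a x ⊎-dec carried? s I c x
  ... | no b≢d = raise K₁ d raisedAtD? , record
    { inversions = raise-IsTreeInversions raisedAtD? K₁-IsTreeInversions (RaisedAtD-Raisable b≢d)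
    ; I⊑K = λ y x _ → ≤-trans (raise-≥ I b (carried? s I a) y x) (raise-≥ K₁ d raisedAtD? y x)
    ; raised-ba = ≤-trans (≤-reflexive (sym (raise-hit I b (carried? s I a) (inj₁ refl))))
                          (raise-≥ K₁ d raisedAtD? b a)
    ; raised-dc = ≤-reflexive (sym (trans (raise-hit K₁ d raisedAtD? (inj₁ (inj₁ refl))) (cong suc (K₁-row-d b≢d c))))
    ; by-at-most-one = by-at-most-one
    ; increments = increments
    }
    where
    by-at-most-one : ∀ y x → raise K₁ d raisedAtD? y x ≤ suc (I y x)
    by-at-most-one y x with y ≟ d
    ... | yes refl = subst (λ k → raise K₁ y raisedAtD? y x ≤ suc k) (K₁-row-d b≢d x) (raise-≤ K₁ y raisedAtD? y x)
    ... | no y≢d = subst (_≤ suc (I y x)) (sym (raise-other K₁ d raisedAtD? y≢d)) (raise-≤ I b (carried? s I a) y x)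

    increments : ∀ y x → I y x < raise K₁ d raisedAtD? y x → Increment y x
    increments y x lt with y ≟ d
    ... | no y≢d = inj₁ (raise-increased I b (carried? s I a) y x (subst (I y x <_) (raise-other K₁ d raisedAtD? y≢d) lt))
    ... | yes refl with raise-increased K₁ y raisedAtD? y x (subst (_< raise K₁ y raisedAtD? y x) (sym (K₁-row-d b≢d x)) lt)
    ...   | _ , inj₁ cx = inj₂ (inj₁ (refl , cx))
    ...   | _ , inj₂ (F , cx) = inj₂ (inj₂ (F , refl , cx))

  join-raises-F : ∀ Z Q W → Transitive n W → plusPair s I b a ⊑[ n ] Z → plusPair s I d c ⊑[ n ] Q →
    Z ⊑[ n ] W → Q ⊑[ n ] W → FCase → ∀ x → 1 ≤ x → CarriedA x → I d x < W d x
  join-raises-F Z Q W Wtr I⁺⊑Z I⁺⊑Q Z⊑W Q⊑W F@(refl , Iba≡0) x 1≤x cx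
    rewrite FCase-row-d F 1≤x cx = ≤-trans Wda≥ (Wdx≥Wda cx)
    where
    Wba>0 : 0 < W b a
    Wba>0 = ≤-trans (subst (λ k → suc k ≤ Z b a) Iba≡0 (plusPair-⊑-hit s n I b a AI.not-last Z (1≤a , a<b , b≤n) I⁺⊑Z))
                    (Z⊑W b a (1≤a , a<b , b≤n))
    Wda≥ : suc (I d b) ≤ W d a
    Wda≥ with Wtr a b d 1≤a a<b c<d d≤n
    ... | inj₁ e = ⊥-elim (<⇒≢ Wba>0 (sym e))
    ... | inj₂ l = ≤-trans (≤-trans (plusPair-⊑-hit s n I d b CI.not-last Q (1≤c , c<d , d≤n) I⁺⊑Q)
                                    (Q⊑W d b (1≤c , c<d , d≤n))) l
    Wdx≥Wda : CarriedA x → W d a ≤ W d x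
    Wdx≥Wda (inj₁ refl) = ≤-refl
    Wdx≥Wda (inj₂ (x<a , 0<Iax , _)) with Wtr x a d 1≤x x<a (<-trans a<b c<d) d≤n
    ... | inj₁ e = ⊥-elim (<⇒≢ (<-≤-trans 0<Iax (≤-trans (plusPair-⊑⇒⊑ s n I b a AI.not-last Z I⁺⊑Z a x pair)
                                                          (Z⊑W a x pair))) (sym e))
      where pair = 1≤x , x<a , A.a≤n
    ... | inj₂ l = l

indicator : Bool → ℕ
indicator b = if b then 1 else 0

indicator-∨ : ∀ p q → indicator (p ∨ q) ≡ indicator p ⊔ indicator q
indicator-∨ true true = refl
indicator-∨ true false = refl
indicator-∨ false q = refl

∸-indicator : ∀ {t w} → t ≤ w → w ≤ suc t → w ∸ t ≡ indicator (does (t <? w))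
∸-indicator {t} {w} t≤w w≤1+t with t ≟ w
... | yes refl rewrite dec-false (t <? t) (<-irrefl refl) = n∸n≡0 t
... | no t≢w rewrite ≤-antisym w≤1+t (≤∧≢⇒< t≤w t≢w) | dec-true (t <? suc t) ≤-refl = m+n∸n≡m 1 t

T-∨₃ : ∀ p q r → (T p ⊎ T q ⊎ T r) ⇔ T ((p ∨ q) ∨ r)
T-∨₃ p q r = mk⇔ join₃ split₃
  where
  join₃ : T p ⊎ T q ⊎ T r → T ((p ∨ q) ∨ r)
  join₃ (inj₁ t) = Equivalence.from (T-∨ {p ∨ q} {r}) (inj₁ (Equivalence.from (T-∨ {p} {q}) (inj₁ t)))
  join₃ (inj₂ (inj₁ t)) = Equivalence.from (T-∨ {p ∨ q} {r}) (inj₁ (Equivalence.from (T-∨ {p} {q}) (inj₂ t)))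
  join₃ (inj₂ (inj₂ t)) = Equivalence.from (T-∨ {p ∨ q} {r}) (inj₂ t)
  split₃ : T ((p ∨ q) ∨ r) → T p ⊎ T q ⊎ T r
  split₃ t with Equivalence.to (T-∨ {p ∨ q} {r}) t
  ... | inj₂ tr = inj₂ (inj₂ tr)
  ... | inj₁ tpq = map₂ inj₁ (Equivalence.to (T-∨ {p} {q}) tpq)

T-⇔⇒≡ : ∀ {p q} → T p ⇔ T q → p ≡ q
T-⇔⇒≡ {false} {false} _ = refl
T-⇔⇒≡ {false} {true} p⇔q = ⊥-elim (Equivalence.from p⇔q tt)
T-⇔⇒≡ {true} {false} p⇔q = ⊥-elim (Equivalence.to p⇔q tt)
T-⇔⇒≡ {true} {true} _ = refl

T-does : ∀ {A : Set} (a? : Dec A) → T (does a?) ⇔ A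
T-does (yes a) = mk⇔ (λ _ → a) (λ _ → tt)
T-does (no ¬a) = mk⇔ (λ ()) ¬a

isChild0⇒≡0 : ∀ {k} → T (isChild0 (just k)) → k ≡ 0
isChild0⇒≡0 {zero} _ = refl

module JoinOfRotations (s : ℕ → ℕ) (n : ℕ) (T₀ : Tree) (sd : IsSDecTree s n T₀)
  (a b c d : ℕ) (1≤a : 1 ≤ a) (b≤n : b ≤ n) (1≤c : 1 ≤ c) (d≤n : d ≤ n) (a<c : a < c)
  (ascA : IsTreeAscent s T₀ a b) (ascC : IsTreeAscent s T₀ c d)
  (Z Q : Tree) (rotZ : IsRotation s n T₀ a b Z) (rotQ : IsRotation s n T₀ c d Q)
  (W : Tree) (join : IsJoin s n Z Q W) where

  I : Multiset
  I = inv s T₀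
  module TA = TreeAscent s n T₀ sd a b 1≤a b≤n ascA
  module TC = TreeAscent s n T₀ sd c d 1≤c d≤n ascC
  open TwoAscents s n I (inv-IsTreeInversions s n T₀ sd) a b c d 1≤a (proj₁ ascA) b≤n 1≤c (proj₁ ascC) d≤n a<c
    TA.ascent-inversions TC.ascent-inversions

  K : Multiset
  K = proj₁ upper-bound
  module UB = UpperBound (proj₂ upper-bound)

  private
    realised : ∃ λ U → IsSDecTree s n U × (∀ y x → Pair n y x → inv s U y x ≡ K y x)
    realised = realise s n K UB.inversions
    U : Tree
    U = proj₁ realised
    U-sdec : IsSDecTree s n U
    U-sdec = proj₁ (proj₂ realised)
    invU≡K : ∀ y x → Pair n y x → inv s U y x ≡ K y x
    invU≡K = proj₂ (proj₂ realised)

    I⁺⊑Z : plusPair s I b a ⊑[ n ] inv s Z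
    I⁺⊑Z = proj₁ (proj₂ (proj₂ rotZ))
    I⁺⊑Q : plusPair s I d c ⊑[ n ] inv s Q
    I⁺⊑Q = proj₁ (proj₂ (proj₂ rotQ))
    Z⊑W : Z ⪯[ s , n ] W
    Z⊑W = proj₁ (proj₂ join)
    Q⊑W : Q ⪯[ s , n ] W
    Q⊑W = proj₁ (proj₂ (proj₂ join))

    rotation⪯U : ∀ {e f R} → IsRotation s n T₀ e f R → I f e < s f → suc (I f e) ≤ K f e → R ⪯[ s , n ] U
    rotation⪯U {e} {f} rot room hit = proj₂ (proj₂ (proj₂ rot)) (inv s U) (inv-transitive s n U U-sdec)
      λ y x p → subst (plusPair s I f e y x ≤_) (sym (invU≡K y x p)) (⊑-plusPair s n I f e room K UB.I⊑K hit y x p)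

  W⊑K : inv s W ⊑[ n ] K
  W⊑K y x p = ≤-trans (proj₂ (proj₂ (proj₂ join)) U U-sdec
      (rotation⪯U rotZ AI.not-last UB.raised-ba) (rotation⪯U rotQ CI.not-last UB.raised-dc) y x p)
    (≤-reflexive (invU≡K y x p))

  I⊑W : I ⊑[ n ] inv s W
  I⊑W y x p = ≤-trans (plusPair-⊑⇒⊑ s n I b a AI.not-last (inv s Z) I⁺⊑Z y x p) (Z⊑W y x p)

  raised : Tree → ℕ → ℕ → Bool
  raised R y x = does (I y x <? inv s R y x)

  -- By definition, Fset T₀ a b c d y x is indicator (F-bool y x) and Aset s T₀ R y x is indicator (raised R y x).
  F-bool : ℕ → ℕ → Bool
  F-bool y x = does (b ≟ c) ∧ isChild0 (childIdx T₀ c a) ∧ does (y ≟ d) ∧ inSubNot0 T₀ a x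

  F-bool⇔ : ∀ y x → 1 ≤ x → T (F-bool y x) ⇔ (FCase × (y ≡ d) × CarriedA x)
  F-bool⇔ y x 1≤x = mk⇔ to from
    where
    to : T (F-bool y x) → FCase × (y ≡ d) × CarriedA x
    to t with Equivalence.to (T-∧ {does (b ≟ c)}) t
    ... | tbc , t' with Equivalence.to (T-does (b ≟ c)) tbc | Equivalence.to (T-∧ {isChild0 (childIdx T₀ c a)}) t'
    ...   | refl | t0 , t'' with Equivalence.to (T-∧ {does (y ≟ d)}) t''
    ...     | tyd , ta rewrite TA.childIdx-ascent =
      (refl , isChild0⇒≡0 t0) , Equivalence.to (T-does (y ≟ d)) tyd , TA.inSubNot0⇒Carried x (Equivalence.to T-≡ ta)
    from : FCase × (y ≡ d) × CarriedA x → T (F-bool y x)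
    from ((refl , Iba≡0) , refl , cx) rewrite TA.childIdx-ascent | Iba≡0
      | dec-true (b ≟ b) refl | dec-true (y ≟ y) refl = Equivalence.from T-≡ (TA.Carried⇒inSubNot0 x 1≤x cx)

  increases⇔ : ∀ y x → Pair n y x →
    (I y x < inv s W y x) ⇔ (I y x < inv s Z y x ⊎ I y x < inv s Q y x ⊎ (FCase × (y ≡ d) × CarriedA x))
  increases⇔ y x p@(1≤x , _) = mk⇔ to from
    where
    to : I y x < inv s W y x → I y x < inv s Z y x ⊎ I y x < inv s Q y x ⊎ (FCase × (y ≡ d) × CarriedA x)
    to lt with UB.increments y x (<-≤-trans lt (W⊑K y x p))
    ... | inj₁ (refl , cx) = inj₁ (A.rotation-raises (inv s Z) (inv-transitive s n Z (proj₁ rotZ)) I⁺⊑Z x 1≤x cx)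
    ... | inj₂ (inj₁ (refl , cx)) = inj₂ (inj₁ (C.rotation-raises (inv s Q) (inv-transitive s n Q (proj₁ rotQ)) I⁺⊑Q x 1≤x cx))
    ... | inj₂ (inj₂ f) = inj₂ (inj₂ f)

    from : I y x < inv s Z y x ⊎ I y x < inv s Q y x ⊎ (FCase × (y ≡ d) × CarriedA x) → I y x < inv s W y x
    from (inj₁ lt) = <-≤-trans lt (Z⊑W y x p)
    from (inj₂ (inj₁ lt)) = <-≤-trans lt (Q⊑W y x p)
    from (inj₂ (inj₂ (F , refl , cx))) =
      join-raises-F (inv s Z) (inv s Q) (inv s W) (inv-transitive s n W (proj₁ join)) I⁺⊑Z I⁺⊑Q Z⊑W Q⊑W F x 1≤x cx

  raised-join : ∀ y x → Pair n y x → raised W y x ≡ (raised Z y x ∨ raised Q y x) ∨ F-bool y x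
  raised-join y x p@(1≤x , _) = T-⇔⇒≡ (begin
    T (raised W y x)                                  ∼⟨ T-does (I y x <? inv s W y x) ⟩
    I y x < inv s W y x                               ∼⟨ increases⇔ y x p ⟩
    (I y x < inv s Z y x ⊎ I y x < inv s Q y x ⊎ (FCase × (y ≡ d) × CarriedA x))
      ∼⟨ ⇔-sym (T-does (I y x <? inv s Z y x) ⊎-⇔ T-does (I y x <? inv s Q y x) ⊎-⇔ F-bool⇔ y x 1≤x) ⟩
    (T (raised Z y x) ⊎ T (raised Q y x) ⊎ T (F-bool y x)) ∼⟨ T-∨₃ (raised Z y x) (raised Q y x) (F-bool y x) ⟩
    T ((raised Z y x ∨ raised Q y x) ∨ F-bool y x)    ∎)
    where open EquationalReasoning {k = equivalence}

lemma3p14 : (s : ℕ → ℕ) (n : ℕ) (T : Tree) → IsSDecTree s n T →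
    (a b c d : ℕ) → 1 ≤ a → b ≤ n → 1 ≤ c → d ≤ n → a < c →
    IsTreeAscent s T a b → IsTreeAscent s T c d →
    (Z Q : Tree) → IsRotation s n T a b Z → IsRotation s n T c d Q →
    (W : Tree) → IsJoin s n Z Q W →
    ∀ y x → Pair n y x →
      inv s W y x ∸ inv s T y x
        ≡ (Aset s T Z y x ⊔ Aset s T Q y x) ⊔ Fset T a b c d y x
lemma3p14 s n T sd a b c d 1≤a b≤n 1≤c d≤n a<c ascA ascC Z Q rotZ rotQ W join y x p = begin
  inv s W y x ∸ inv s T y x
    ≡⟨ ∸-indicator (I⊑W y x p) (≤-trans (W⊑K y x p) (UB.by-at-most-one y x)) ⟩
  indicator (raised W y x)
    ≡⟨ cong indicator (raised-join y x p) ⟩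
  indicator ((raised Z y x ∨ raised Q y x) ∨ F-bool y x)
    ≡⟨ indicator-∨ (raised Z y x ∨ raised Q y x) (F-bool y x) ⟩
  indicator (raised Z y x ∨ raised Q y x) ⊔ indicator (F-bool y x)
    ≡⟨ cong (_⊔ indicator (F-bool y x)) (indicator-∨ (raised Z y x) (raised Q y x)) ⟩
  (Aset s T Z y x ⊔ Aset s T Q y x) ⊔ Fset T a b c d y x ∎
  where
  open ≡-Reasoning
  open JoinOfRotations s n T sd a b c d 1≤a b≤n 1≤c d≤n a<c ascA ascC Z Q rotZ rotQ W join
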